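{- Let $1\le k\le n-1$ be integers and let $D_{k,n}(t)$ be the Ehrhart polynomial of the matroid polytope of the minimal matroid $T_{k,n}$. Then $D_{k,n}(t)$ has positive coefficients. Moreover, writing $d_{k,n,m}:=[t^m]D_{k,n}(t)$ for the coefficient of $t^m$, one has \[D_{k,n}(t) = \frac{1}{\binom{n-1}{k-1}} \binom{t+n-k}{n-k} \sum_{j=0}^{k-1}\binom{n-k-1+j}{j}\binom{t+j}{j}\] and \[ d_{k,n,m} = \frac{1}{(n-1)!} \sum_{j=0}^{k-1}\sum_{\ell=0}^j \frac{(k-1)!}{j!} \binom{n-k-1+j}{j} {j+1 \brack{\ell+1}} {n-k+1 \brack{m-\ell+1}}.\]
   Context: For integers $1\le k\le n-1$, $T_{k,n}$ denotes the cycle matroid (graphic matroid) of the graph obtained from a cycle of length $k+1$ by replacing one of its edges with $n-k$ parallel edges; it is a matroid of rank $k$ on $n$ elements. For a matroid $M$ on the ground set $\{1,\dots,n\}$ with set of bases $\mathscr{B}(M)$, its matroid (basis) polytope is $\mathscr{P}(M)=\operatorname{conv}\{e_B : B\in\mathscr{B}(M)\}\subseteq\mathbb{R}^n$, where $e_B=\sum_{i\in B}e_i$. The Ehrhart polynomial of a lattice polytope $\mathscr{P}\subseteq\mathbb{R}^n$ is the polynomial $i(\mathscr{P},t)$ with $i(\mathscr{P},t)=\#(t\mathscr{P}\cap\mathbb{Z}^n)$ for all integers $t\ge0$. ${a \brack b}$ denotes the (unsigned) Stirling number of the first kind. -}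

module Defs where

open import Data.Nat as ℕ using (ℕ; zero; suc; _∸_; _<_; _≤_; _<ᵇ_; _≤ᵇ_)
open import Data.Nat.Combinatorics using (_C_)
open import Data.Nat.Base using (_!)
open import Data.Integer as ℤ using (ℤ; +_)
open import Data.Rational as ℚ using (ℚ; 0ℚ; _/_)
open import Data.Bool using (Bool; true; false; if_then_else_)
open import Data.Fin using (Fin; toℕ)
open import Data.Fin.Subset using (Subset; _∈_; ∣_∣)
open import Data.Vec using (Vec; lookup)
open import Data.List using (List; []; _∷_; length; map; foldr)
open import Data.List.Relation.Unary.All using (All)
open import Data.List.Relation.Unary.Unique.Propositional using (Unique)
import Data.List.Membership.Propositional as LM
open import Data.Product using (Σ; _×_; _,_; proj₁; proj₂)
open import Function.Bundles using (_⇔_)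
open import Relation.Binary.PropositionalEquality using (_≡_)

sumℚ : ℕ → (ℕ → ℚ) → ℚ
sumℚ zero    f = 0ℚ
sumℚ (suc n) f = sumℚ n f ℚ.+ f n

sumℕ : ℕ → (ℕ → ℕ) → ℕ
sumℕ zero    f = 0
sumℕ (suc n) f = sumℕ n f ℕ.+ f n

ℕtoℚ : ℕ → ℚ
ℕtoℚ a = (+ a) / 1

-- a / b in ℚ (only used with b ≠ 0; returns 0 if b = 0)
ratio : ℕ → ℕ → ℚ
ratio a zero    = 0ℚ
ratio a (suc b) = (+ a) / suc b

stirling1 : ℕ → ℕ → ℕ
stirling1 zero    zero    = 1
stirling1 zero    (suc k) = 0
stirling1 (suc n) zero    = 0
stirling1 (suc n) (suc k) = n ℕ.* stirling1 n (suc k) ℕ.+ stirling1 n k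

-- The graph underlying T_{k,n}:
-- vertices 0,…,k (as naturals); edges indexed by Fin n.
-- Edge e with toℕ e = i < k joins i and i+1 (the k kept edges of the
-- (k+1)-cycle); every edge e with toℕ e ≥ k joins k and 0 (the n-k
-- parallel copies of the replaced cycle edge).

endpoints : (k : ℕ) {n : ℕ} → Fin n → ℕ × ℕ
endpoints k e = if toℕ e <ᵇ k then (toℕ e , suc (toℕ e)) else (k , 0)

data Reach (k : ℕ) {n : ℕ} (F : Subset n) (u : ℕ) : ℕ → Set where
  here : Reach k F u u
  fwd  : (e : Fin n) → e ∈ F → Reach k F u (proj₁ (endpoints k e)) →
         Reach k F u (proj₂ (endpoints k e))
  bwd  : (e : Fin n) → e ∈ F → Reach k F u (proj₂ (endpoints k e)) →
         Reach k F u (proj₁ (endpoints k e))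

-- Bases of the cycle matroid of this connected graph (k+1 vertices):
-- spanning trees, i.e. edge sets of size k connecting all vertices.
IsBasisT : (k n : ℕ) → Subset n → Set
IsBasisT k n B = (∣ B ∣ ≡ k) × (∀ v → v ≤ k → Reach k B 0 v)

-- Dilated matroid polytope  t·P(T_{k,n}) = { Σ λ_B e_B : λ_B ≥ 0, Σ λ_B = t }
-- (a finite nonnegative combination of basis indicator vectors).

indicator : {n : ℕ} → Subset n → Fin n → ℚ
indicator B i = if lookup B i then ℚ.1ℚ else 0ℚ

InDilate : (k n t : ℕ) → Vec ℤ n → Set
InDilate k n t x =
  Σ (List (Subset n × ℚ)) λ L →
    All (λ p → IsBasisT k n (proj₁ p) × (0ℚ ℚ.≤ proj₂ p)) L ×
    (foldr (λ p s → proj₂ p ℚ.+ s) 0ℚ L ≡ ℕtoℚ t) ×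
    (∀ i → (lookup x i) / 1 ≡ foldr (λ p s → proj₂ p ℚ.* indicator (proj₁ p) i ℚ.+ s) 0ℚ L)

LatticeCount : (k n t c : ℕ) → Set
LatticeCount k n t c =
  Σ (List (Vec ℤ n)) λ L →
    Unique L × (∀ x → (x LM.∈ L) ⇔ InDilate k n t x) × (length L ≡ c)

Dformula : (k n t : ℕ) → ℚ
Dformula k n t =
  ratio 1 ((n ∸ 1) C (k ∸ 1)) ℚ.*
  (ℕtoℚ ((t ℕ.+ (n ∸ k)) C (n ∸ k)) ℚ.*
   ℕtoℚ (sumℕ k (λ j → ((n ∸ k ∸ 1 ℕ.+ j) C j) ℕ.* ((t ℕ.+ j) C j))))

-- [ n-k+1 , m-ℓ+1 ], which is 0 when m-ℓ+1 ≤ 0 (i.e. ℓ > m)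
stirTerm : (k n m ℓ : ℕ) → ℕ
stirTerm k n m ℓ = if ℓ ≤ᵇ m then stirling1 (n ∸ k ℕ.+ 1) (m ∸ ℓ ℕ.+ 1) else 0

dcoeff : (k n m : ℕ) → ℚ
dcoeff k n m =
  ratio 1 ((n ∸ 1) !) ℚ.*
  sumℚ k (λ j → sumℚ (suc j) (λ ℓ →
    ratio ((k ∸ 1) !) (j !) ℚ.*
    ℕtoℚ (((n ∸ k ∸ 1 ℕ.+ j) C j) ℕ.* stirling1 (suc j) (suc ℓ) ℕ.* stirTerm k n m ℓ)))

Dpoly : (k n t : ℕ) → ℚ
Dpoly k n t = sumℚ n (λ m → dcoeff k n m ℚ.* ℕtoℚ (t ℕ.^ m))

{-# OPTIONS --safe #-}
-- A lattice point x of t·P(T_{k,n}) is determined by the deficits d_j = t − x_j on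
-- the k path edges and the values c_q on the n − k parallel edges. Every basis has
-- k edges, at most one of them parallel, so Σ d = Σ c ≤ t; conversely every such
-- pair is reached by adding, t times, either the path or a basis obtained by
-- swapping one path edge for one parallel edge. Counting pairs of weak compositions
-- gives D_{k,n}(t) = Σ_{s≤t} C(s+n−k−1, n−k−1) C(s+k−1, k−1), which an induction on t
-- turns into the product formula. Writing j! C(t+j, j) and (n−k)! C(t+n−k, n−k) as
-- rising factorials, i.e. through Stirling numbers of the first kind, yields the
-- coefficient formula; its summands are nonnegative, and for each m < n one of them
-- is positive.

module Submission where

open import Defs
open import Data.Nat using (ℕ; zero; suc; _<_)
import Data.Nat.Properties as ℕP
open import Algebra.Bundles using (CommutativeSemiring; CommutativeRing)
import Algebra.Properties.CommutativeSemigroup as CommSemigroupProperties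
import Relation.Binary.Reasoning.Setoid as ≈-Reasoning

module FiniteSum {c ℓ} (R : CommutativeSemiring c ℓ) where

  open CommutativeSemiring R hiding (zero)
  open CommSemigroupProperties +-commutativeSemigroup using (interchange)
  open ≈-Reasoning setoid

  module Properties
    (sum : ℕ → (ℕ → Carrier) → Carrier)
    (sum-zero : ∀ f → sum zero f ≈ 0#)
    (sum-suc : ∀ n f → sum (suc n) f ≈ sum n f + f n)
    where

    sum-cong : ∀ n {f g : ℕ → Carrier} → (∀ i → i < n → f i ≈ g i) → sum n f ≈ sum n g
    sum-cong zero    {f} {g} _ = trans (sum-zero f) (sym (sum-zero g))
    sum-cong (suc n) {f} {g} f≗g = begin
      sum (suc n) f  ≈⟨ sum-suc n f ⟩
      sum n f + f n  ≈⟨ +-cong (sum-cong n (λ i i<n → f≗g i (ℕP.m<n⇒m<1+n i<n))) (f≗g n (ℕP.n<1+n n)) ⟩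
      sum n g + g n  ≈⟨ sum-suc n g ⟨
      sum (suc n) g  ∎

    sum-0# : ∀ n → sum n (λ _ → 0#) ≈ 0#
    sum-0# zero    = sum-zero _
    sum-0# (suc n) = trans (sum-suc n _) (trans (+-identityʳ _) (sum-0# n))

    sum-+ : ∀ n (f g : ℕ → Carrier) → sum n (λ i → f i + g i) ≈ sum n f + sum n g
    sum-+ zero    f g = trans (sum-zero _) (sym (trans (+-cong (sum-zero f) (sum-zero g)) (+-identityʳ 0#)))
    sum-+ (suc n) f g = begin
      sum (suc n) (λ i → f i + g i)         ≈⟨ sum-suc n _ ⟩
      sum n (λ i → f i + g i) + (f n + g n) ≈⟨ +-congʳ (sum-+ n f g) ⟩
      (sum n f + sum n g) + (f n + g n)     ≈⟨ interchange (sum n f) (sum n g) (f n) (g n) ⟩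
      (sum n f + f n) + (sum n g + g n)     ≈⟨ +-cong (sum-suc n f) (sum-suc n g) ⟨
      sum (suc n) f + sum (suc n) g         ∎

    sum-*ˡ : ∀ n x (f : ℕ → Carrier) → sum n (λ i → x * f i) ≈ x * sum n f
    sum-*ˡ zero    x f = trans (sum-zero _) (sym (trans (*-congˡ (sum-zero f)) (zeroʳ x)))
    sum-*ˡ (suc n) x f = begin
      sum (suc n) (λ i → x * f i)     ≈⟨ sum-suc n _ ⟩
      sum n (λ i → x * f i) + x * f n ≈⟨ +-congʳ (sum-*ˡ n x f) ⟩
      x * sum n f + x * f n           ≈⟨ distribˡ x (sum n f) (f n) ⟨
      x * (sum n f + f n)             ≈⟨ *-congˡ (sum-suc n f) ⟨
      x * sum (suc n) f               ∎

    sum-*ʳ : ∀ n x (f : ℕ → Carrier) → sum n (λ i → f i * x) ≈ sum n f * x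
    sum-*ʳ n x f = trans (sum-cong n (λ i _ → *-comm (f i) x)) (trans (sum-*ˡ n x f) (*-comm x _))

    sum-swap : ∀ m n (h : ℕ → ℕ → Carrier) → sum m (λ i → sum n (h i)) ≈ sum n (λ j → sum m (λ i → h i j))
    sum-swap zero    n h = trans (sum-zero _) (sym (trans (sum-cong n (λ j _ → sum-zero _)) (sum-0# n)))
    sum-swap (suc m) n h = begin
      sum (suc m) (λ i → sum n (h i))                 ≈⟨ sum-suc m _ ⟩
      sum m (λ i → sum n (h i)) + sum n (h m)         ≈⟨ +-congʳ (sum-swap m n h) ⟩
      sum n (λ j → sum m (λ i → h i j)) + sum n (h m) ≈⟨ sum-+ n _ (h m) ⟨
      sum n (λ j → sum m (λ i → h i j) + h m j)       ≈⟨ sum-cong n (λ j _ → sum-suc m _) ⟨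
      sum n (λ j → sum (suc m) (λ i → h i j))         ∎

    sum-shift : ∀ n (f : ℕ → Carrier) → sum (suc n) f ≈ f 0 + sum n (λ i → f (suc i))
    sum-shift zero    f = begin
      sum 1 f            ≈⟨ sum-suc 0 f ⟩
      sum 0 f + f 0      ≈⟨ +-congʳ (sum-zero f) ⟩
      0# + f 0           ≈⟨ +-comm 0# (f 0) ⟩
      f 0 + 0#           ≈⟨ +-congˡ (sum-zero _) ⟨
      f 0 + sum 0 (λ i → f (suc i)) ∎
    sum-shift (suc n) f = begin
      sum (suc (suc n)) f                         ≈⟨ sum-suc (suc n) f ⟩
      sum (suc n) f + f (suc n)                   ≈⟨ +-congʳ (sum-shift n f) ⟩
      f 0 + sum n (λ i → f (suc i)) + f (suc n)   ≈⟨ +-assoc (f 0) _ _ ⟩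
      f 0 + (sum n (λ i → f (suc i)) + f (suc n)) ≈⟨ +-congˡ (sum-suc n _) ⟨
      f 0 + sum (suc n) (λ i → f (suc i))         ∎

open import Data.Nat using (_≤_; _+_; _*_; _∸_; _^_; z≤n; s≤s; _!; _≤ᵇ_)
open import Data.Nat.Combinatorics using (_C_; nCk+nC[k+1]≡[n+1]C[k+1])
open import Data.Nat.Tactic.RingSolver using (solve-∀)
open import Algebra.Properties.CommutativeSemigroup ℕP.+-commutativeSemigroup using (interchange)
open import Algebra.Properties.CommutativeSemigroup ℕP.*-commutativeSemigroup using (x∙yz≈y∙xz)
import Data.Integer as ℤ
open ℤ using (ℤ; +_)
import Data.Integer.Properties as ℤP
import Data.Integer.Tactic.RingSolver as ℤ-Solver
import Data.Rational as ℚ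
open ℚ using (ℚ; 0ℚ; 1ℚ) renaming (_<_ to _<ℚ_)
import Data.Rational.Properties as ℚP
open import Algebra.Properties.CommutativeSemigroup
  (CommutativeSemiring.+-commutativeSemigroup (CommutativeRing.commutativeSemiring ℚP.+-*-commutativeRing))
  using () renaming (interchange to ℚinterchange)
import Data.Rational.Unnormalised as ℚᵘ
import Data.Rational.Unnormalised.Properties as ℚᵘP
open import Data.Fin as F using (Fin; toℕ; fromℕ<; _↑ˡ_; _↑ʳ_)
import Data.Fin.Properties as FP
open import Data.Fin.Subset using (Subset; ∣_∣; ⊤; ⁅_⁆) renaming (⊥ to ∅; _∈_ to _∈ₛ_)
open import Data.Fin.Subset.Properties using (∣⊤∣≡n; ∣⊥∣≡0; ∣⁅x⁆∣≡1; x∈⁅x⁆)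
open import Data.Vec as V using (Vec; []; _∷_; _++_; lookup)
import Data.Vec.Properties as VP
open import Data.List as L using (List; []; _∷_; map; length; cartesianProduct; foldr)
import Data.List.Properties as LP
open import Data.List.Membership.Propositional using (_∈_)
open import Data.List.Membership.Propositional.Properties
  using (∈-map⁺; ∈-map⁻; ∈-++⁺ˡ; ∈-++⁺ʳ; ∈-++⁻; ∈-cartesianProduct⁺; ∈-cartesianProduct⁻)
open import Data.List.Relation.Unary.Any using (here)
open import Data.List.Relation.Unary.All using (All; []; _∷_)
import Data.List.Relation.Unary.AllPairs as AllPairs
open import Data.List.Relation.Unary.Unique.Propositional using (Unique)
import Data.List.Relation.Unary.Unique.Propositional.Properties as Unique
open import Data.Bool using (true; false; T; if_then_else_)
open import Data.Bool.Properties using (T-≡)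
open import Data.Product using (Σ; _×_; _,_; proj₁; proj₂)
open import Data.Sum using (_⊎_; inj₁; inj₂)
open import Data.Empty using (⊥; ⊥-elim)
open import Data.Unit using (tt)
open import Function.Bundles using (Equivalence; mk⇔)
open import Relation.Nullary using (¬_; yes; no)
open import Relation.Binary.PropositionalEquality

ℤtoℚ : ℤ → ℚ
ℤtoℚ i = i ℚ./ 1

private
  toℚᵘ-ℤtoℚ : ∀ i → ℚ.toℚᵘ (ℤtoℚ i) ℚᵘ.≃ ℚᵘ.mkℚᵘ i 0
  toℚᵘ-ℤtoℚ i = ℚP.toℚᵘ-fromℚᵘ (ℚᵘ.mkℚᵘ i 0)

ℤtoℚ-+ : ∀ i j → ℤtoℚ (i ℤ.+ j) ≡ ℤtoℚ i ℚ.+ ℤtoℚ j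
ℤtoℚ-+ i j = ℚP.toℚᵘ-injective (ℚᵘP.≃-trans (toℚᵘ-ℤtoℚ (i ℤ.+ j)) (ℚᵘP.≃-trans denominators-one
  (ℚᵘP.≃-sym (ℚᵘP.≃-trans (ℚP.toℚᵘ-homo-+ (ℤtoℚ i) (ℤtoℚ j)) (ℚᵘP.+-cong (toℚᵘ-ℤtoℚ i) (toℚᵘ-ℤtoℚ j))))))
  where
  denominators-one : ℚᵘ.mkℚᵘ (i ℤ.+ j) 0 ℚᵘ.≃ (ℚᵘ.mkℚᵘ i 0 ℚᵘ.+ ℚᵘ.mkℚᵘ j 0)
  denominators-one = ℚᵘ.*≡* (cong₂ (λ u v → (u ℤ.+ v) ℤ.* + 1) (sym (ℤP.*-identityʳ i)) (sym (ℤP.*-identityʳ j)))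

ℤtoℚ-* : ∀ i j → ℤtoℚ (i ℤ.* j) ≡ ℤtoℚ i ℚ.* ℤtoℚ j
ℤtoℚ-* i j = ℚP.toℚᵘ-injective (ℚᵘP.≃-trans (toℚᵘ-ℤtoℚ (i ℤ.* j)) (ℚᵘP.≃-trans (ℚᵘ.*≡* refl)
  (ℚᵘP.≃-sym (ℚᵘP.≃-trans (ℚP.toℚᵘ-homo-* (ℤtoℚ i) (ℤtoℚ j)) (ℚᵘP.*-cong (toℚᵘ-ℤtoℚ i) (toℚᵘ-ℤtoℚ j))))))

ℤtoℚ-cancel-≤ : ∀ {i j} → ℤtoℚ i ℚ.≤ ℤtoℚ j → i ℤ.≤ j
ℤtoℚ-cancel-≤ {i} {j} le
  with ℚᵘP.≤-respʳ-≃ (toℚᵘ-ℤtoℚ j) (ℚᵘP.≤-respˡ-≃ (toℚᵘ-ℤtoℚ i) (ℚP.toℚᵘ-mono-≤ le))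
... | ℚᵘ.*≤* h = subst₂ ℤ._≤_ (ℤP.*-identityʳ i) (ℤP.*-identityʳ j) h

ℤtoℚ-mono-≤ : ∀ {i j} → i ℤ.≤ j → ℤtoℚ i ℚ.≤ ℤtoℚ j
ℤtoℚ-mono-≤ {i} {j} le = ℚP.toℚᵘ-cancel-≤
  (ℚᵘP.≤-respʳ-≃ (ℚᵘP.≃-sym (toℚᵘ-ℤtoℚ j)) (ℚᵘP.≤-respˡ-≃ (ℚᵘP.≃-sym (toℚᵘ-ℤtoℚ i))
    (ℚᵘ.*≤* (subst₂ ℤ._≤_ (sym (ℤP.*-identityʳ i)) (sym (ℤP.*-identityʳ j)) le))))

ℤtoℚ-injective : ∀ {i j} → ℤtoℚ i ≡ ℤtoℚ j → i ≡ j
ℤtoℚ-injective e = ℤP.≤-antisym (ℤtoℚ-cancel-≤ (ℚP.≤-reflexive e)) (ℤtoℚ-cancel-≤ (ℚP.≤-reflexive (sym e)))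

ℕtoℚ-+ : ∀ a b → ℕtoℚ (a + b) ≡ ℕtoℚ a ℚ.+ ℕtoℚ b
ℕtoℚ-+ a b = ℤtoℚ-+ (+ a) (+ b)

ℕtoℚ-* : ∀ a b → ℕtoℚ (a * b) ≡ ℕtoℚ a ℚ.* ℕtoℚ b
ℕtoℚ-* a b = trans (cong ℤtoℚ (ℤP.pos-* a b)) (ℤtoℚ-* (+ a) (+ b))

ℕtoℚ-injective : ∀ {a b} → ℕtoℚ a ≡ ℕtoℚ b → a ≡ b
ℕtoℚ-injective e = ℤP.+-injective (ℤtoℚ-injective e)

ℕtoℚ-cancel-≤ : ∀ {a b} → ℕtoℚ a ℚ.≤ ℕtoℚ b → a ≤ b
ℕtoℚ-cancel-≤ le = ℤP.drop‿+≤+ (ℤtoℚ-cancel-≤ le)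

ℕtoℚ-mono-≤ : ∀ {a b} → a ≤ b → ℕtoℚ a ℚ.≤ ℕtoℚ b
ℕtoℚ-mono-≤ le = ℤtoℚ-mono-≤ (ℤ.+≤+ le)

ratio-*-ℕtoℚ : ∀ a b c d e → 0 < b → 0 < e → a * c * e ≡ d * b → ratio a b ℚ.* ℕtoℚ c ≡ ratio d e
ratio-*-ℕtoℚ a (suc b) c d (suc e) _ _ h = ℚP.toℚᵘ-injective
  (ℚᵘP.≃-trans (ℚP.toℚᵘ-homo-* (ratio a (suc b)) (ℕtoℚ c))
  (ℚᵘP.≃-trans (ℚᵘP.*-cong (toℚᵘ-ratio a b) (toℚᵘ-ratio c 0))
  (ℚᵘP.≃-trans cross (ℚᵘP.≃-sym (toℚᵘ-ratio d e)))))
  where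
  toℚᵘ-ratio : ∀ a b → ℚ.toℚᵘ (ratio a (suc b)) ℚᵘ.≃ ℚᵘ.mkℚᵘ (+ a) b
  toℚᵘ-ratio a b = ℚP.toℚᵘ-fromℚᵘ (ℚᵘ.mkℚᵘ (+ a) b)
  cross : (ℚᵘ.mkℚᵘ (+ a) b ℚᵘ.* ℚᵘ.mkℚᵘ (+ c) 0) ℚᵘ.≃ ℚᵘ.mkℚᵘ (+ d) e
  cross = ℚᵘ.*≡* (begin
    (+ a ℤ.* + c) ℤ.* + suc e  ≡⟨ cong (ℤ._* + suc e) (ℤP.pos-* a c) ⟨
    + (a * c) ℤ.* + suc e      ≡⟨ ℤP.pos-* (a * c) (suc e) ⟨
    + (a * c * suc e)          ≡⟨ cong +_ (trans h (cong (λ z → d * suc z) (sym (ℕP.*-identityʳ b)))) ⟩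
    + (d * suc (b * 1))        ≡⟨ ℤP.pos-* d (suc (b * 1)) ⟩
    + d ℤ.* + suc (b * 1)      ∎)
    where open ≡-Reasoning

ratio-*-cancelʳ : ∀ p q w → 0 < q → ratio p q ℚ.* ℕtoℚ (q * w) ≡ ℕtoℚ (p * w)
ratio-*-cancelʳ p q w q>0 = ratio-*-ℕtoℚ p q (q * w) (p * w) 1 q>0 (s≤s z≤n) (shuffle p q w)
  where
  shuffle : ∀ p q w → p * (q * w) * 1 ≡ p * w * q
  shuffle = solve-∀

ratio-*-cancel-common : ∀ u v y → 0 < u → 0 < v → ratio 1 (u * v) ℚ.* ℕtoℚ (v * y) ≡ ratio 1 u ℚ.* ℕtoℚ y
ratio-*-cancel-common u v y u>0 v>0 =
  trans (ratio-*-ℕtoℚ 1 (u * v) (v * y) y u (ℕP.*-mono-≤ u>0 v>0) u>0 (shuffle u v y))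
        (sym (ratio-*-ℕtoℚ 1 u y y u u>0 u>0 (cong (_* u) (ℕP.*-identityˡ y))))
  where
  shuffle : ∀ u v y → 1 * (v * y) * u ≡ y * (u * v)
  shuffle = solve-∀

ratio-nonNeg : ∀ a b → 0ℚ ℚ.≤ ratio a b
ratio-nonNeg a zero    = ℚP.≤-refl
ratio-nonNeg a (suc b) = ℚP.nonNegative⁻¹ _ {{ℚP.normalize-nonNeg a (suc b)}}

ratio-pos : ∀ a b → 0 < a → 0 < b → 0ℚ ℚ.< ratio a b
ratio-pos (suc a) (suc b) _ _ = ℚP.positive⁻¹ _ {{ℚP.normalize-pos (suc a) (suc b)}}

ℕtoℚ-nonNeg : ∀ a → 0ℚ ℚ.≤ ℕtoℚ a
ℕtoℚ-nonNeg a = ℕtoℚ-mono-≤ {0} {a} z≤n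

ℕtoℚ-pos : ∀ a → 0 < a → 0ℚ ℚ.< ℕtoℚ a
ℕtoℚ-pos a a>0 = ratio-pos a 1 a>0 (s≤s z≤n)

nonNeg*nonNeg : ∀ {p q} → 0ℚ ℚ.≤ p → 0ℚ ℚ.≤ q → 0ℚ ℚ.≤ p ℚ.* q
nonNeg*nonNeg {p} {q} p≥0 q≥0 =
  ℚP.nonNegative⁻¹ _ {{ℚP.nonNeg*nonNeg⇒nonNeg p {{ℚ.nonNegative p≥0}} q {{ℚ.nonNegative q≥0}}}}

pos*pos : ∀ {p q} → 0ℚ ℚ.< p → 0ℚ ℚ.< q → 0ℚ ℚ.< p ℚ.* q
pos*pos {p} {q} p>0 q>0 = ℚP.positive⁻¹ _ {{ℚP.pos*pos⇒pos p {{ℚ.positive p>0}} q {{ℚ.positive q>0}}}}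

open FiniteSum.Properties ℕP.+-*-commutativeSemiring sumℕ (λ _ → refl) (λ _ _ → refl)
  using () renaming (sum-cong to sumℕ-cong; sum-0# to sumℕ-0; sum-+ to sumℕ-+; sum-*ˡ to sumℕ-*ˡ;
                     sum-*ʳ to sumℕ-*ʳ; sum-swap to sumℕ-swap; sum-shift to sumℕ-shift)
open FiniteSum.Properties (CommutativeRing.commutativeSemiring ℚP.+-*-commutativeRing) sumℚ (λ _ → refl) (λ _ _ → refl)
  using () renaming (sum-cong to sumℚ-cong; sum-*ˡ to sumℚ-*ˡ; sum-*ʳ to sumℚ-*ʳ; sum-swap to sumℚ-swap)

sumℚ-ℕtoℚ : ∀ n (f : ℕ → ℕ) → sumℚ n (λ i → ℕtoℚ (f i)) ≡ ℕtoℚ (sumℕ n f)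
sumℚ-ℕtoℚ zero    f = refl
sumℚ-ℕtoℚ (suc n) f = trans (cong (ℚ._+ ℕtoℚ (f n)) (sumℚ-ℕtoℚ n f)) (sym (ℕtoℚ-+ (sumℕ n f) (f n)))

sumℚ-nonNeg : ∀ n (f : ℕ → ℚ) → (∀ i → i < n → 0ℚ ℚ.≤ f i) → 0ℚ ℚ.≤ sumℚ n f
sumℚ-nonNeg zero    f f≥0 = ℚP.≤-refl
sumℚ-nonNeg (suc n) f f≥0 = ℚP.≤-trans (ℚP.≤-reflexive (sym (ℚP.+-identityʳ 0ℚ)))
  (ℚP.+-mono-≤ (sumℚ-nonNeg n f (λ i i<n → f≥0 i (ℕP.m<n⇒m<1+n i<n))) (f≥0 n (ℕP.n<1+n n)))

term≤sumℚ : ∀ n (f : ℕ → ℚ) → (∀ i → i < n → 0ℚ ℚ.≤ f i) → ∀ i → i < n → f i ℚ.≤ sumℚ n f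
term≤sumℚ (suc n) f f≥0 i i<1+n with ℕP.m≤n⇒m<n∨m≡n (ℕP.≤-pred i<1+n)
... | inj₁ i<n = ℚP.≤-trans (term≤sumℚ n f f≥0′ i i<n)
  (ℚP.≤-trans (ℚP.≤-reflexive (sym (ℚP.+-identityʳ _))) (ℚP.+-monoʳ-≤ (sumℚ n f) (f≥0 n (ℕP.n<1+n n))))
  where
  f≥0′ : ∀ i → i < n → 0ℚ ℚ.≤ f i
  f≥0′ i i<n = f≥0 i (ℕP.m<n⇒m<1+n i<n)
... | inj₂ refl = ℚP.≤-trans (ℚP.≤-reflexive (sym (ℚP.+-identityˡ _)))
  (ℚP.+-monoˡ-≤ (f i) (sumℚ-nonNeg i f (λ j j<i → f≥0 j (ℕP.m<n⇒m<1+n j<i))))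

binomial : ℕ → ℕ → ℕ
binomial zero    zero    = 1
binomial zero    (suc k) = 0
binomial (suc n) zero    = 1
binomial (suc n) (suc k) = binomial n k + binomial n (suc k)

C≡binomial : ∀ n k → n C k ≡ binomial n k
C≡binomial zero    zero    = refl
C≡binomial zero    (suc k) = refl
C≡binomial (suc n) zero    = refl
C≡binomial (suc n) (suc k) =
  trans (sym (nCk+nC[k+1]≡[n+1]C[k+1] n k)) (cong₂ _+_ (C≡binomial n k) (C≡binomial n (suc k)))

binomial-n-0 : ∀ n → binomial n 0 ≡ 1
binomial-n-0 zero    = refl
binomial-n-0 (suc n) = refl

binomial-n<k : ∀ n k → n < k → binomial n k ≡ 0
binomial-n<k zero    (suc k) _          = refl
binomial-n<k (suc n) (suc k) (s≤s n<k) =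
  cong₂ _+_ (binomial-n<k n k n<k) (binomial-n<k n (suc k) (ℕP.m<n⇒m<1+n n<k))

binomial-n-n : ∀ n → binomial n n ≡ 1
binomial-n-n zero    = refl
binomial-n-n (suc n) = cong₂ _+_ (binomial-n-n n) (binomial-n<k n (suc n) (ℕP.n<1+n n))

binomial-n-1 : ∀ n → binomial n 1 ≡ n
binomial-n-1 zero    = refl
binomial-n-1 (suc n) = cong₂ _+_ (binomial-n-0 n) (binomial-n-1 n)

binomial-pos : ∀ n k → k ≤ n → 0 < binomial n k
binomial-pos n       zero    _        = subst (0 <_) (sym (binomial-n-0 n)) (s≤s z≤n)
binomial-pos (suc n) (suc k) (s≤s k≤n) = ℕP.<-≤-trans (binomial-pos n k k≤n) (ℕP.m≤m+n _ _)

binomial-absorb : ∀ n k → suc k * binomial (suc n) (suc k) ≡ suc n * binomial n k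
binomial-absorb zero zero = refl
binomial-absorb zero (suc k) =
  trans (cong (suc (suc k) *_) (binomial-n<k 1 (suc (suc k)) (s≤s (s≤s z≤n)))) (ℕP.*-zeroʳ (suc (suc k)))
binomial-absorb (suc n) zero =
  trans (ℕP.*-identityˡ _) (cong₂ _+_ (binomial-n-0 (suc n)) (trans (binomial-n-1 (suc n)) (sym (ℕP.*-identityʳ _))))
binomial-absorb (suc n) (suc k) = begin
  suc (suc k) * (Y + Z)                               ≡⟨ expand (suc k) Y Z ⟩
  suc k * Y + Y + suc (suc k) * Z                     ≡⟨ cong₂ (λ u v → u + Y + v) (binomial-absorb n k) (binomial-absorb n (suc k)) ⟩
  suc n * binomial n k + Y + suc n * binomial n (suc k) ≡⟨ collect (suc n) (binomial n k) (binomial n (suc k)) ⟩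
  suc (suc n) * Y                                     ∎
  where
  open ≡-Reasoning
  Y Z : ℕ
  Y = binomial (suc n) (suc k)
  Z = binomial (suc n) (suc (suc k))
  expand : ∀ q x y → suc q * (x + y) ≡ q * x + x + suc q * y
  expand = solve-∀
  collect : ∀ p x y → p * x + (x + y) + p * y ≡ suc p * (x + y)
  collect = solve-∀

+-suc-comm : ∀ m n → m + suc n ≡ n + suc m
+-suc-comm m n = trans (ℕP.+-suc m n) (trans (cong suc (ℕP.+-comm m n)) (sym (ℕP.+-suc n m)))

binomial-suc-ratio : ∀ k m → suc k * binomial (k + suc m) (suc k) ≡ suc m * binomial (k + suc m) k
binomial-suc-ratio k m = ℕP.+-cancelˡ-≡ (suc k * binomial n k) _ _ (begin
  suc k * binomial n k + suc k * binomial n (suc k) ≡⟨ ℕP.*-distribˡ-+ (suc k) (binomial n k) (binomial n (suc k)) ⟨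
  suc k * binomial (suc n) (suc k)                  ≡⟨ binomial-absorb n k ⟩
  suc n * binomial n k                              ≡⟨ ℕP.*-distribʳ-+ (binomial n k) (suc k) (suc m) ⟩
  suc k * binomial n k + suc m * binomial n k       ∎)
  where
  n : ℕ
  n = k + suc m
  open ≡-Reasoning

binomial*factorials : ∀ k m → binomial (k + m) k * (k ! * m !) ≡ (k + m) !
binomial*factorials zero m =
  trans (cong (_* (1 * m !)) (binomial-n-0 m)) (trans (ℕP.*-identityˡ _) (ℕP.*-identityˡ _))
binomial*factorials (suc k) m = ℕP.*-cancelˡ-≡ _ _ (suc k) (begin
  suc k * (binomial (suc k + m) (suc k) * (suc k ! * m !))
    ≡⟨ regroup (suc k) (binomial (suc k + m) (suc k)) (k !) (m !) ⟩
  (suc k * binomial (suc k + m) (suc k)) * (suc k * (k ! * m !))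
    ≡⟨ cong (_* (suc k * (k ! * m !))) (binomial-absorb (k + m) k) ⟩
  (suc (k + m) * binomial (k + m) k) * (suc k * (k ! * m !))
    ≡⟨ regroup′ (suc (k + m)) (binomial (k + m) k) (suc k) (k ! * m !) ⟩
  suc k * (suc (k + m) * (binomial (k + m) k * (k ! * m !)))
    ≡⟨ cong (λ z → suc k * (suc (k + m) * z)) (binomial*factorials k m) ⟩
  suc k * (suc k + m) ! ∎)
  where
  open ≡-Reasoning
  regroup : ∀ p x f g → p * (x * ((p * f) * g)) ≡ (p * x) * (p * (f * g))
  regroup = solve-∀
  regroup′ : ∀ a x p y → (a * x) * (p * y) ≡ p * (a * (x * y))
  regroup′ = solve-∀

hockey-stick : ∀ a k → sumℕ (suc k) (λ j → binomial (a + j) j) ≡ binomial (k + suc a) k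
hockey-stick a zero    = trans (cong (λ z → binomial z 0) (ℕP.+-identityʳ a))
                               (trans (binomial-n-0 a) (sym (binomial-n-0 (suc a))))
hockey-stick a (suc k) =
  cong₂ _+_ (hockey-stick a k) (cong (λ z → binomial z (suc k)) (+-suc-comm a k))

-- The number of pairs of weak compositions of s into A+1 and K+1 parts is
-- C(s+A,A) C(s+K,K), so the lattice-point count is the partial sum below.

module _ (A : ℕ) where

  diagonalSum : ℕ → ℕ → ℕ
  diagonalSum K t = sumℕ (suc t) (λ s → binomial (s + A) A * binomial (s + K) K)

  ehrhartSum : ℕ → ℕ → ℕ
  ehrhartSum K t = sumℕ (suc K) (λ j → binomial (A + j) j * binomial (t + j) j)

  private
    G : ℕ → ℕ → ℕ
    G K t = sumℕ K (λ j → binomial (A + suc j) j * binomial (t + j) (suc j))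

    D : ℕ → ℕ → ℕ
    D K t = sumℕ K (λ j → binomial (A + suc j) (suc j) * binomial (t + suc j) j)

    split : ∀ K t → binomial (K + suc A) K * binomial (t + K) K ≡ ehrhartSum K t + G K t
    split zero t = begin
      binomial (suc A) 0 * binomial (t + 0) 0 ≡⟨ cong (1 *_) (binomial-n-0 (t + 0)) ⟩
      1 ≡⟨ sym (cong₂ (λ u v → (0 + u * v) + 0) (binomial-n-0 (A + 0)) (binomial-n-0 (t + 0))) ⟩
      ehrhartSum 0 t + G 0 t ∎
      where open ≡-Reasoning
    split (suc K) t = begin
      (X0 + X1) * binomial (t + suc K) (suc K)  ≡⟨ cong ((X0 + X1) *_) Ysplit ⟩
      (X0 + X1) * (Y0 + Y1)                     ≡⟨ expand X0 X1 Y0 Y1 ⟩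
      X0 * Y0 + X1 * (Y0 + Y1) + X0 * Y1        ≡⟨ cong (λ z → z + X1 * (Y0 + Y1) + X0 * Y1) (split K t) ⟩
      ehrhartSum K t + G K t + X1 * (Y0 + Y1) + X0 * Y1
        ≡⟨ regroup (ehrhartSum K t) (G K t) (X1 * (Y0 + Y1)) (X0 * Y1) ⟩
      (ehrhartSum K t + X1 * (Y0 + Y1)) + (G K t + X0 * Y1)
        ≡⟨ cong₂ (λ u v → (ehrhartSum K t + u) + (G K t + v))
             (cong₂ _*_ (cong (λ z → binomial z (suc K)) (+-suc-comm A K)) Ysplit)
             (cong (λ z → binomial z K * Y1) (+-suc-comm A K)) ⟨
      ehrhartSum (suc K) t + G (suc K) t ∎
      where
      open ≡-Reasoning
      X0 X1 Y0 Y1 : ℕ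
      X0 = binomial (K + suc A) K
      X1 = binomial (K + suc A) (suc K)
      Y0 = binomial (t + K) K
      Y1 = binomial (t + K) (suc K)
      Ysplit : binomial (t + suc K) (suc K) ≡ Y0 + Y1
      Ysplit = cong (λ z → binomial z (suc K)) (ℕP.+-suc t K)
      expand : ∀ a b c d → (a + b) * (c + d) ≡ a * c + b * (c + d) + a * d
      expand = solve-∀
      regroup : ∀ a b c d → a + b + c + d ≡ (a + c) + (b + d)
      regroup = solve-∀

    ehrhartSum-suc : ∀ K t → ehrhartSum K (suc t) ≡ ehrhartSum K t + D K t
    ehrhartSum-suc K t = begin
      ehrhartSum K (suc t)
        ≡⟨ sumℕ-shift K _ ⟩
      B0 * binomial (suc t + 0) 0 + sumℕ K (λ j → Bj j * binomial (suc t + suc j) (suc j))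
        ≡⟨ cong₂ _+_ (cong (B0 *_) (trans (binomial-n-0 (suc t + 0)) (sym (binomial-n-0 (t + 0)))))
                     (sumℕ-cong K (λ j _ → ℕP.*-distribˡ-+ (Bj j) (binomial (t + suc j) j) (binomial (t + suc j) (suc j)))) ⟩
      B0 * binomial (t + 0) 0 + sumℕ K (λ j → Bj j * binomial (t + suc j) j + Bj j * binomial (t + suc j) (suc j))
        ≡⟨ cong (λ z → B0 * binomial (t + 0) 0 + z) (sumℕ-+ K _ _) ⟩
      B0 * binomial (t + 0) 0 + (D K t + R)
        ≡⟨ regroup (B0 * binomial (t + 0) 0) (D K t) R ⟩
      (B0 * binomial (t + 0) 0 + R) + D K t
        ≡⟨ cong (_+ D K t) (sumℕ-shift K _) ⟨
      ehrhartSum K t + D K t ∎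
      where
      open ≡-Reasoning
      B0 : ℕ
      B0 = binomial (A + 0) 0
      Bj : ℕ → ℕ
      Bj j = binomial (A + suc j) (suc j)
      R : ℕ
      R = sumℕ K (λ j → Bj j * binomial (t + suc j) (suc j))
      regroup : ∀ a b c → a + (b + c) ≡ (a + c) + b
      regroup = solve-∀

    termwise : ∀ t j → binomial (t + suc A) A * (binomial (A + suc j) j * binomial (suc t + j) (suc j))
                     ≡ binomial (t + suc A) (suc A) * (binomial (A + suc j) (suc j) * binomial (t + suc j) j)
    termwise t j = cancel (begin
      suc A * (suc j * (suc t * (Ba * (Yj * Z1))))
        ≡⟨ cong (λ z → suc A * (suc j * (suc t * (Ba * (Yj * z))))) (cong (λ z → binomial z (suc j)) (sym (ℕP.+-suc t j))) ⟩
      suc A * (suc j * (suc t * (Ba * (Yj * Zs))))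
        ≡⟨ regroup (suc A) (suc j) (suc t) Ba Yj Zs ⟩
      (suc t * Ba) * ((suc A * Yj) * (suc j * Zs))
        ≡⟨ cong₂ (λ u v → u * (v * (suc j * Zs))) (absorbed A t) (absorbed j A) ⟨
      (suc A * Bs) * ((suc j * Ys) * (suc j * Zs))
        ≡⟨ cong (λ z → (suc A * Bs) * ((suc j * Ys) * z)) (absorbed j t) ⟩
      (suc A * Bs) * ((suc j * Ys) * (suc t * Zj))
        ≡⟨ regroup′ (suc A) (suc j) (suc t) Bs Ys Zj ⟩
      suc A * (suc j * (suc t * (Bs * (Ys * Zj)))) ∎)
      where
      open ≡-Reasoning
      Ba Bs Yj Ys Z1 Zs Zj : ℕ
      Ba = binomial (t + suc A) A
      Bs = binomial (t + suc A) (suc A)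
      Yj = binomial (A + suc j) j
      Ys = binomial (A + suc j) (suc j)
      Z1 = binomial (suc t + j) (suc j)
      Zs = binomial (t + suc j) (suc j)
      Zj = binomial (t + suc j) j
      absorbed : ∀ a b → suc a * binomial (b + suc a) (suc a) ≡ suc b * binomial (b + suc a) a
      absorbed a b = subst (λ z → suc a * binomial z (suc a) ≡ suc b * binomial z a) (+-suc-comm a b) (binomial-suc-ratio a b)
      cancel : ∀ {x y} → suc A * (suc j * (suc t * x)) ≡ suc A * (suc j * (suc t * y)) → x ≡ y
      cancel e = ℕP.*-cancelˡ-≡ _ _ (suc t) (ℕP.*-cancelˡ-≡ _ _ (suc j) (ℕP.*-cancelˡ-≡ _ _ (suc A) e))
      regroup : ∀ a j t x y z → a * (j * (t * (x * (y * z)))) ≡ (t * x) * ((a * y) * (j * z))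
      regroup = solve-∀
      regroup′ : ∀ a j t x y z → (a * x) * ((j * y) * (t * z)) ≡ a * (j * (t * (x * (y * z))))
      regroup′ = solve-∀

    G≡D : ∀ K t → binomial (t + suc A) A * G K (suc t) ≡ binomial (t + suc A) (suc A) * D K t
    G≡D K t = trans (sym (sumℕ-*ˡ K (binomial (t + suc A) A) _))
      (trans (sumℕ-cong K (λ j _ → termwise t j)) (sumℕ-*ˡ K (binomial (t + suc A) (suc A)) _))

  -- Induction on t: `split` writes C(K+A+1,K) C(t+1+K,K) as ehrhartSum + G, and `G≡D`
  -- together with Pascal's rule for C(t+A+2, A+1) matches this with the increment of the
  -- right-hand side, in which ehrhartSum grows by D.
  diagonalSum-closedForm : ∀ K t → binomial (K + suc A) K * diagonalSum K t ≡ binomial (t + suc A) (suc A) * ehrhartSum K t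
  diagonalSum-closedForm K zero = begin
    X * (0 + binomial (0 + A) A * binomial (0 + K) K) ≡⟨ cong (λ z → X * (0 + z)) (cong₂ _*_ (binomial-n-n A) (binomial-n-n K)) ⟩
    X * 1                                   ≡⟨ ℕP.*-identityʳ _ ⟩
    X                                       ≡⟨ hockey-stick A K ⟨
    sumℕ (suc K) (λ j → binomial (A + j) j) ≡⟨ sumℕ-cong (suc K) (λ j _ → sym (trans (cong (binomial (A + j) j *_) (binomial-n-n j)) (ℕP.*-identityʳ _))) ⟩
    ehrhartSum K 0                          ≡⟨ ℕP.*-identityˡ _ ⟨
    1 * ehrhartSum K 0                      ≡⟨ cong (_* ehrhartSum K 0) (binomial-n-n (suc A)) ⟨
    binomial (suc A) (suc A) * ehrhartSum K 0 ∎
    where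
    open ≡-Reasoning
    X : ℕ
    X = binomial (K + suc A) K
  diagonalSum-closedForm K (suc t) = begin
    X * (diagonalSum K t + binomial (suc t + A) A * binomial (suc t + K) K)
      ≡⟨ ℕP.*-distribˡ-+ X _ _ ⟩
    X * diagonalSum K t + X * (binomial (suc t + A) A * binomial (suc t + K) K)
      ≡⟨ cong₂ _+_ (diagonalSum-closedForm K t) (swap X (binomial (suc t + A) A) _) ⟩
    Bs * H t + binomial (suc t + A) A * (X * binomial (suc t + K) K)
      ≡⟨ cong (λ z → Bs * H t + binomial z A * (X * binomial (suc t + K) K)) (sym (ℕP.+-suc t A)) ⟩
    Bs * H t + Ba * (X * binomial (suc t + K) K)
      ≡⟨ cong (λ z → Bs * H t + Ba * z) (split K (suc t)) ⟩
    Bs * H t + Ba * (H (suc t) + G K (suc t))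
      ≡⟨ cong (λ z → Bs * H t + z) (ℕP.*-distribˡ-+ Ba _ _) ⟩
    Bs * H t + (Ba * H (suc t) + Ba * G K (suc t))
      ≡⟨ cong (λ z → Bs * H t + (Ba * H (suc t) + z)) (G≡D K t) ⟩
    Bs * H t + (Ba * H (suc t) + Bs * D K t)
      ≡⟨ regroup Bs (H t) Ba (H (suc t)) (D K t) ⟩
    Ba * H (suc t) + Bs * (H t + D K t)
      ≡⟨ cong (λ z → Ba * H (suc t) + Bs * z) (ehrhartSum-suc K t) ⟨
    Ba * H (suc t) + Bs * H (suc t)
      ≡⟨ ℕP.*-distribʳ-+ (H (suc t)) Ba Bs ⟨
    binomial (suc t + suc A) (suc A) * H (suc t) ∎
    where
    open ≡-Reasoning
    X Bs Ba : ℕ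
    H : ℕ → ℕ
    X = binomial (K + suc A) K
    Bs = binomial (t + suc A) (suc A)
    Ba = binomial (t + suc A) A
    H = ehrhartSum K
    swap : ∀ x a b → x * (a * b) ≡ a * (x * b)
    swap = solve-∀
    regroup : ∀ s h a h′ d → s * h + (a * h′ + s * d) ≡ a * h′ + s * (h + d)
    regroup = solve-∀

¬T⇒≡false : ∀ {b} → ¬ T b → b ≡ false
¬T⇒≡false {false} _ = refl
¬T⇒≡false {true}  h = ⊥-elim (h tt)

≤ᵇ-true : ∀ {m n} → m ≤ n → (m ≤ᵇ n) ≡ true
≤ᵇ-true m≤n = Equivalence.to T-≡ (ℕP.≤⇒≤ᵇ m≤n)

≤ᵇ-false : ∀ {m n} → n < m → (m ≤ᵇ n) ≡ false
≤ᵇ-false {m} {n} n<m = ¬T⇒≡false (λ h → ℕP.<⇒≱ n<m (ℕP.≤ᵇ⇒≤ m n h))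

stirling1-n<k : ∀ n k → n < k → stirling1 n k ≡ 0
stirling1-n<k zero    (suc k) _          = refl
stirling1-n<k (suc n) (suc k) (s≤s n<k) =
  trans (cong₂ _+_ (cong (n *_) (stirling1-n<k n (suc k) (ℕP.m<n⇒m<1+n n<k))) (stirling1-n<k n k n<k))
        (cong (_+ 0) (ℕP.*-zeroʳ n))

stirling1-n-n : ∀ n → stirling1 n n ≡ 1
stirling1-n-n zero    = refl
stirling1-n-n (suc n) =
  cong₂ _+_ (trans (cong (n *_) (stirling1-n<k n (suc n) (ℕP.n<1+n n))) (ℕP.*-zeroʳ n)) (stirling1-n-n n)

stirling1-pos : ∀ n k → k ≤ n → 0 < stirling1 (suc n) (suc k)
stirling1-pos zero    zero    _ = s≤s z≤n
stirling1-pos (suc n) zero    _ =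
  ℕP.<-≤-trans (ℕP.*-mono-< {0} {suc n} (s≤s z≤n) (stirling1-pos n zero z≤n)) (ℕP.m≤m+n _ _)
stirling1-pos (suc n) (suc k) (s≤s k≤n) =
  ℕP.<-≤-trans (stirling1-pos n k k≤n) (ℕP.m≤n+m _ (suc n * stirling1 (suc n) (suc (suc k))))

stirling1-risingFactorial : ∀ j t → sumℕ (suc j) (λ l → stirling1 (suc j) (suc l) * t ^ l) ≡ j ! * binomial (t + j) j
stirling1-risingFactorial zero    t = sym (cong (1 *_) (binomial-n-0 (t + 0)))
stirling1-risingFactorial (suc j) t = begin
  sumℕ (suc (suc j)) (λ l → (suc j * st (suc l) + st l) * t ^ l)
    ≡⟨ sumℕ-cong (suc (suc j)) (λ l _ → ℕP.*-distribʳ-+ (t ^ l) (suc j * st (suc l)) (st l)) ⟩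
  sumℕ (suc (suc j)) (λ l → suc j * st (suc l) * t ^ l + st l * t ^ l)
    ≡⟨ sumℕ-+ (suc (suc j)) _ _ ⟩
  sumℕ (suc (suc j)) (λ l → suc j * st (suc l) * t ^ l) + sumℕ (suc (suc j)) (λ l → st l * t ^ l)
    ≡⟨ cong₂ _+_ scaledPart shiftedPart ⟩
  suc j * R + t * R
    ≡⟨ ℕP.*-distribʳ-+ R (suc j) t ⟨
  (suc j + t) * R
    ≡⟨ cong ((suc j + t) *_) (stirling1-risingFactorial j t) ⟩
  (suc j + t) * (j ! * binomial (t + j) j)
    ≡⟨ regroup j t (j !) (binomial (t + j) j) ⟩
  j ! * (suc (t + j) * binomial (t + j) j)
    ≡⟨ cong (j ! *_) (binomial-absorb (t + j) j) ⟨
  j ! * (suc j * binomial (suc (t + j)) (suc j))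
    ≡⟨ regroup′ (j !) (suc j) _ ⟩
  suc j ! * binomial (suc (t + j)) (suc j)
    ≡⟨ cong (λ z → suc j ! * binomial z (suc j)) (ℕP.+-suc t j) ⟨
  suc j ! * binomial (t + suc j) (suc j) ∎
  where
  open ≡-Reasoning
  st : ℕ → ℕ
  R : ℕ
  st = stirling1 (suc j)
  R = sumℕ (suc j) (λ l → st (suc l) * t ^ l)
  regroup : ∀ j t f b → (suc j + t) * (f * b) ≡ f * (suc (t + j) * b)
  regroup = solve-∀
  regroup′ : ∀ f s b → f * (s * b) ≡ s * f * b
  regroup′ = solve-∀
  scaledPart : sumℕ (suc (suc j)) (λ l → suc j * st (suc l) * t ^ l) ≡ suc j * R
  scaledPart = begin
    sumℕ (suc j) (λ l → suc j * st (suc l) * t ^ l) + suc j * st (suc (suc j)) * t ^ suc j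
      ≡⟨ cong₂ _+_ (trans (sumℕ-cong (suc j) (λ l _ → ℕP.*-assoc (suc j) (st (suc l)) (t ^ l))) (sumℕ-*ˡ (suc j) (suc j) _))
                   (cong (λ z → suc j * z * t ^ suc j) (stirling1-n<k (suc j) (suc (suc j)) (ℕP.n<1+n _))) ⟩
    suc j * R + suc j * 0 * t ^ suc j ≡⟨ cong (λ z → suc j * R + z * t ^ suc j) (ℕP.*-zeroʳ (suc j)) ⟩
    suc j * R + 0                     ≡⟨ ℕP.+-identityʳ _ ⟩
    suc j * R                         ∎
  shiftedPart : sumℕ (suc (suc j)) (λ l → st l * t ^ l) ≡ t * R
  shiftedPart = begin
    sumℕ (suc (suc j)) (λ l → st l * t ^ l)          ≡⟨ sumℕ-shift (suc j) _ ⟩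
    0 * 1 + sumℕ (suc j) (λ l → st (suc l) * (t * t ^ l)) ≡⟨ sumℕ-cong (suc j) (λ l _ → x∙yz≈y∙xz (st (suc l)) t (t ^ l)) ⟩
    sumℕ (suc j) (λ l → t * (st (suc l) * t ^ l))    ≡⟨ sumℕ-*ˡ (suc j) t _ ⟩
    t * R                                            ∎

-- The coefficient of t^m in t^l · Σ_r g r t^r.
shiftedCoeff : (ℕ → ℕ) → ℕ → ℕ → ℕ
shiftedCoeff g m l = if l ≤ᵇ m then g (m ∸ l) else 0

sum-shiftedCoeff : ∀ g t l M →
  sumℕ (l + M) (λ m → shiftedCoeff g m l * t ^ m) ≡ t ^ l * sumℕ M (λ r → g r * t ^ r)
sum-shiftedCoeff g t l zero = begin
  sumℕ (l + 0) (λ m → shiftedCoeff g m l * t ^ m) ≡⟨ cong (λ z → sumℕ z (λ m → shiftedCoeff g m l * t ^ m)) (ℕP.+-identityʳ l) ⟩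
  sumℕ l (λ m → shiftedCoeff g m l * t ^ m)       ≡⟨ sumℕ-cong l (λ m m<l → cong (λ b → (if b then g (m ∸ l) else 0) * t ^ m) (≤ᵇ-false m<l)) ⟩
  sumℕ l (λ _ → 0)                                ≡⟨ sumℕ-0 l ⟩
  0                                               ≡⟨ ℕP.*-zeroʳ (t ^ l) ⟨
  t ^ l * 0 ∎
  where open ≡-Reasoning
sum-shiftedCoeff g t l (suc M) = begin
  sumℕ (l + suc M) (λ m → shiftedCoeff g m l * t ^ m)
    ≡⟨ cong (λ z → sumℕ z (λ m → shiftedCoeff g m l * t ^ m)) (ℕP.+-suc l M) ⟩
  sumℕ (l + M) (λ m → shiftedCoeff g m l * t ^ m) + shiftedCoeff g (l + M) l * t ^ (l + M)
    ≡⟨ cong₂ _+_ (sum-shiftedCoeff g t l M) lastTerm ⟩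
  t ^ l * sumℕ M (λ r → g r * t ^ r) + t ^ l * (g M * t ^ M)
    ≡⟨ ℕP.*-distribˡ-+ (t ^ l) _ _ ⟨
  t ^ l * sumℕ (suc M) (λ r → g r * t ^ r) ∎
  where
  open ≡-Reasoning
  lastTerm : shiftedCoeff g (l + M) l * t ^ (l + M) ≡ t ^ l * (g M * t ^ M)
  lastTerm = begin
    shiftedCoeff g (l + M) l * t ^ (l + M)
      ≡⟨ cong₂ _*_ (trans (cong (λ b → if b then g (l + M ∸ l) else 0) (≤ᵇ-true (ℕP.m≤m+n l M))) (cong g (ℕP.m+n∸m≡n l M)))
                   (ℕP.^-distribˡ-+-* t l M) ⟩
    g M * (t ^ l * t ^ M) ≡⟨ x∙yz≈y∙xz (g M) (t ^ l) (t ^ M) ⟩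
    t ^ l * (g M * t ^ M) ∎

sum-powers-vanishing : ∀ a (g : ℕ → ℕ) t → (∀ r → a < r → g r ≡ 0) →
  ∀ p → sumℕ (suc a + p) (λ r → g r * t ^ r) ≡ sumℕ (suc a) (λ r → g r * t ^ r)
sum-powers-vanishing a g t g≡0 zero = cong (λ z → sumℕ z (λ r → g r * t ^ r)) (ℕP.+-identityʳ (suc a))
sum-powers-vanishing a g t g≡0 (suc p) = begin
  sumℕ (suc a + suc p) (λ r → g r * t ^ r)
    ≡⟨ cong (λ z → sumℕ z (λ r → g r * t ^ r)) (ℕP.+-suc (suc a) p) ⟩
  sumℕ (suc a + p) (λ r → g r * t ^ r) + g (suc a + p) * t ^ (suc a + p)
    ≡⟨ cong₂ _+_ (sum-powers-vanishing a g t g≡0 p) (cong (_* t ^ (suc a + p)) (g≡0 _ (s≤s (ℕP.m≤m+n a p)))) ⟩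
  sumℕ (suc a) (λ r → g r * t ^ r) + 0 ≡⟨ ℕP.+-identityʳ _ ⟩
  sumℕ (suc a) (λ r → g r * t ^ r) ∎
  where open ≡-Reasoning

cauchy-product : ∀ a j N (f g : ℕ → ℕ) t → (∀ r → a < r → g r ≡ 0) → j + suc a ≤ N →
  sumℕ N (λ m → sumℕ (suc j) (λ l → f l * shiftedCoeff g m l) * t ^ m)
  ≡ sumℕ (suc j) (λ l → f l * t ^ l) * sumℕ (suc a) (λ r → g r * t ^ r)
cauchy-product a j N f g t g≡0 j+a<N = begin
  sumℕ N (λ m → sumℕ (suc j) (λ l → f l * shiftedCoeff g m l) * t ^ m)
    ≡⟨ sumℕ-cong N (λ m _ → sym (sumℕ-*ʳ (suc j) (t ^ m) _)) ⟩
  sumℕ N (λ m → sumℕ (suc j) (λ l → f l * shiftedCoeff g m l * t ^ m))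
    ≡⟨ sumℕ-swap N (suc j) (λ m l → f l * shiftedCoeff g m l * t ^ m) ⟩
  sumℕ (suc j) (λ l → sumℕ N (λ m → f l * shiftedCoeff g m l * t ^ m))
    ≡⟨ sumℕ-cong (suc j) row ⟩
  sumℕ (suc j) (λ l → f l * t ^ l * S)
    ≡⟨ sumℕ-*ʳ (suc j) S _ ⟩
  sumℕ (suc j) (λ l → f l * t ^ l) * S ∎
  where
  open ≡-Reasoning
  S : ℕ
  S = sumℕ (suc a) (λ r → g r * t ^ r)
  row : ∀ l → l < suc j → sumℕ N (λ m → f l * shiftedCoeff g m l * t ^ m) ≡ f l * t ^ l * S
  row l (s≤s l≤j) = begin
    sumℕ N (λ m → f l * shiftedCoeff g m l * t ^ m)      ≡⟨ sumℕ-cong N (λ m _ → ℕP.*-assoc (f l) _ _) ⟩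
    sumℕ N (λ m → f l * (shiftedCoeff g m l * t ^ m))    ≡⟨ sumℕ-*ˡ N (f l) _ ⟩
    f l * sumℕ N (λ m → shiftedCoeff g m l * t ^ m)      ≡⟨ cong (λ z → f l * sumℕ z (λ m → shiftedCoeff g m l * t ^ m)) N≡ ⟨
    f l * sumℕ (l + (suc a + p)) (λ m → shiftedCoeff g m l * t ^ m) ≡⟨ cong (f l *_) (sum-shiftedCoeff g t l (suc a + p)) ⟩
    f l * (t ^ l * sumℕ (suc a + p) (λ r → g r * t ^ r)) ≡⟨ cong (λ z → f l * (t ^ l * z)) (sum-powers-vanishing a g t g≡0 p) ⟩
    f l * (t ^ l * S)                                    ≡⟨ ℕP.*-assoc (f l) _ _ ⟨
    f l * t ^ l * S                                      ∎
    where
    p : ℕ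
    p = N ∸ (l + suc a)
    N≡ : l + (suc a + p) ≡ N
    N≡ = trans (sym (ℕP.+-assoc l (suc a) p)) (ℕP.m+[n∸m]≡n (ℕP.≤-trans (ℕP.+-monoˡ-≤ (suc a) l≤j) j+a<N))

*-pos : ∀ {x y} → 0 < x → 0 < y → 0 < x * y
*-pos {x} {y} = ℕP.*-mono-≤ {1} {x} {1} {y}

-- k = K + 1 and n = K + A + 2 range exactly over 1 ≤ k < n.
module ClosedForms (K A : ℕ) where

  k n a : ℕ
  k = suc K
  n = suc K + suc A
  a = n ∸ k

  k≤n : k ≤ n
  k≤n = ℕP.m≤m+n k (suc A)

  a≡1+A : a ≡ suc A
  a≡1+A = ℕP.m+n∸m≡n k (suc A)

  private
    r : ℚ
    r = ratio 1 ((n ∸ 1) !)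

    ρ : ℕ → ℚ
    ρ j = ratio ((k ∸ 1) !) (j !)

    Bc : ℕ → ℕ
    Bc j = (n ∸ k ∸ 1 + j) C j

    g : ℕ → ℕ
    g r = stirling1 (n ∸ k + 1) (r + 1)

    f : ℕ → ℕ → ℕ
    f j l = Bc j * stirling1 (suc j) (suc l)

    X : ℕ → ℕ → ℕ
    X j m = sumℕ (suc j) (λ l → f j l * shiftedCoeff g m l)

    g-vanishing : ∀ r → a < r → g r ≡ 0
    g-vanishing r a<r = stirling1-n<k (a + 1) (r + 1) (ℕP.+-monoˡ-< 1 a<r)

    g-poly : ∀ t → sumℕ (suc a) (λ r → g r * t ^ r) ≡ a ! * binomial (t + a) a
    g-poly t = trans (sumℕ-cong (suc a) (λ r _ → cong (_* t ^ r) (cong₂ stirling1 (ℕP.+-comm a 1) (ℕP.+-comm r 1))))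
                     (stirling1-risingFactorial a t)

    dcoeff*power : ∀ t m → dcoeff k n m ℚ.* ℕtoℚ (t ^ m) ≡ r ℚ.* sumℚ k (λ j → ρ j ℚ.* ℕtoℚ (X j m * t ^ m))
    dcoeff*power t m = begin
      (r ℚ.* sumℚ k (λ j → sumℚ (suc j) (λ l → ρ j ℚ.* ℕtoℚ (f j l * shiftedCoeff g m l)))) ℚ.* ℕtoℚ (t ^ m)
        ≡⟨ cong (λ z → (r ℚ.* z) ℚ.* ℕtoℚ (t ^ m)) (sumℚ-cong k (λ j _ →
             trans (sumℚ-*ˡ (suc j) (ρ j) _) (cong (ρ j ℚ.*_) (sumℚ-ℕtoℚ (suc j) _)))) ⟩
      (r ℚ.* sumℚ k (λ j → ρ j ℚ.* ℕtoℚ (X j m))) ℚ.* ℕtoℚ (t ^ m)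
        ≡⟨ ℚP.*-assoc r _ _ ⟩
      r ℚ.* (sumℚ k (λ j → ρ j ℚ.* ℕtoℚ (X j m)) ℚ.* ℕtoℚ (t ^ m))
        ≡⟨ cong (r ℚ.*_) (sumℚ-*ʳ k (ℕtoℚ (t ^ m)) _) ⟨
      r ℚ.* sumℚ k (λ j → ρ j ℚ.* ℕtoℚ (X j m) ℚ.* ℕtoℚ (t ^ m))
        ≡⟨ cong (r ℚ.*_) (sumℚ-cong k (λ j _ → trans (ℚP.*-assoc (ρ j) _ _) (cong (ρ j ℚ.*_) (sym (ℕtoℚ-* (X j m) (t ^ m)))))) ⟩
      r ℚ.* sumℚ k (λ j → ρ j ℚ.* ℕtoℚ (X j m * t ^ m)) ∎
      where open ≡-Reasoning

    row-sum : ∀ t j → j < k → sumℕ n (λ m → X j m * t ^ m) ≡ Bc j * (j ! * binomial (t + j) j) * (a ! * binomial (t + a) a)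
    row-sum t j (s≤s j≤K) = begin
      sumℕ n (λ m → X j m * t ^ m)
        ≡⟨ cauchy-product a j n (f j) g t g-vanishing j+a<n ⟩
      sumℕ (suc j) (λ l → f j l * t ^ l) * sumℕ (suc a) (λ r → g r * t ^ r)
        ≡⟨ cong₂ _*_ f-poly (g-poly t) ⟩
      Bc j * (j ! * binomial (t + j) j) * (a ! * binomial (t + a) a) ∎
      where
      open ≡-Reasoning
      j+a<n : j + suc a ≤ n
      j+a<n = ℕP.≤-trans (ℕP.≤-reflexive (ℕP.+-suc j a))
                (ℕP.≤-trans (ℕP.+-monoˡ-≤ a (s≤s j≤K)) (ℕP.≤-reflexive (ℕP.m+[n∸m]≡n k≤n)))
      f-poly : sumℕ (suc j) (λ l → f j l * t ^ l) ≡ Bc j * (j ! * binomial (t + j) j)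
      f-poly = trans (sumℕ-cong (suc j) (λ l _ → ℕP.*-assoc (Bc j) _ _))
                     (trans (sumℕ-*ˡ (suc j) (Bc j) _) (cong (Bc j *_) (stirling1-risingFactorial j t)))

    summand : ℕ → ℕ → ℕ → ℚ
    summand m j l = ρ j ℚ.* ℕtoℚ (f j l * shiftedCoeff g m l)

    summand-nonNeg : ∀ m j l → 0ℚ ℚ.≤ summand m j l
    summand-nonNeg m j l = nonNeg*nonNeg (ratio-nonNeg ((k ∸ 1) !) (j !)) (ℕtoℚ-nonNeg (f j l * shiftedCoeff g m l))

    positive-summand : ∀ m j l → j < k → l < suc j → 0 < f j l * shiftedCoeff g m l → 0ℚ ℚ.< dcoeff k n m
    positive-summand m j l j<k l≤j p = pos*pos (ratio-pos 1 ((n ∸ 1) !) (s≤s z≤n) (ℕP.1≤n! (n ∸ 1)))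
      (ℚP.<-≤-trans (ℚP.<-≤-trans summand-pos (term≤sumℚ (suc j) (summand m j) (λ l _ → summand-nonNeg m j l) l l≤j))
                    (term≤sumℚ k (λ j → sumℚ (suc j) (summand m j)) row-nonNeg j j<k))
      where
      summand-pos : 0ℚ ℚ.< summand m j l
      summand-pos = pos*pos (ratio-pos ((k ∸ 1) !) (j !) (ℕP.1≤n! (k ∸ 1)) (ℕP.1≤n! j)) (ℕtoℚ-pos _ p)
      row-nonNeg : ∀ j → j < k → 0ℚ ℚ.≤ sumℚ (suc j) (summand m j)
      row-nonNeg j _ = sumℚ-nonNeg (suc j) (summand m j) (λ l _ → summand-nonNeg m j l)

    Bc-pos : ∀ j → 0 < Bc j
    Bc-pos j = subst (0 <_) (sym (C≡binomial (n ∸ k ∸ 1 + j) j)) (binomial-pos (n ∸ k ∸ 1 + j) j (ℕP.m≤n+m j (n ∸ k ∸ 1)))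

    rowFactor leadingFactor : ℕ → ℕ
    rowFactor t = sumℕ k (λ j → Bc j * binomial (t + j) j)
    leadingFactor t = a ! * binomial (t + a) a

    -- Summing over m first, each row Σ_m X_{j,m} t^m is a Cauchy product of two rising factorials.
    Dpoly-factorised : ∀ t → Dpoly k n t ≡ r ℚ.* ℕtoℚ (K ! * (rowFactor t * leadingFactor t))
    Dpoly-factorised t = begin
      sumℚ n (λ m → dcoeff k n m ℚ.* ℕtoℚ (t ^ m))
        ≡⟨ sumℚ-cong n (λ m _ → dcoeff*power t m) ⟩
      sumℚ n (λ m → r ℚ.* sumℚ k (λ j → ρ j ℚ.* ℕtoℚ (X j m * t ^ m)))
        ≡⟨ sumℚ-*ˡ n r _ ⟩
      r ℚ.* sumℚ n (λ m → sumℚ k (λ j → ρ j ℚ.* ℕtoℚ (X j m * t ^ m)))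
        ≡⟨ cong (r ℚ.*_) (sumℚ-swap n k _) ⟩
      r ℚ.* sumℚ k (λ j → sumℚ n (λ m → ρ j ℚ.* ℕtoℚ (X j m * t ^ m)))
        ≡⟨ cong (r ℚ.*_) (sumℚ-cong k (λ j j<k → trans (sumℚ-*ˡ n (ρ j) _)
             (cong (ρ j ℚ.*_) (trans (sumℚ-ℕtoℚ n _) (cong ℕtoℚ (trans (row-sum t j j<k) (regroup (Bc j) (j !) (Bt j) Z))))))) ⟩
      r ℚ.* sumℚ k (λ j → ρ j ℚ.* ℕtoℚ (j ! * (Bc j * Bt j * Z)))
        ≡⟨ cong (r ℚ.*_) (sumℚ-cong k (λ j _ → ratio-*-cancelʳ ((k ∸ 1) !) (j !) _ (ℕP.1≤n! j))) ⟩
      r ℚ.* sumℚ k (λ j → ℕtoℚ (K ! * (Bc j * Bt j * Z)))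
        ≡⟨ cong (r ℚ.*_) (sumℚ-ℕtoℚ k _) ⟩
      r ℚ.* ℕtoℚ (sumℕ k (λ j → K ! * (Bc j * Bt j * Z)))
        ≡⟨ cong (λ z → r ℚ.* ℕtoℚ z) (trans (sumℕ-*ˡ k (K !) _) (cong (K ! *_) (sumℕ-*ʳ k Z _))) ⟩
      r ℚ.* ℕtoℚ (K ! * (rowFactor t * Z)) ∎
      where
      open ≡-Reasoning
      Bt : ℕ → ℕ
      Bt j = binomial (t + j) j
      Z : ℕ
      Z = leadingFactor t
      regroup : ∀ b f y z → b * (f * y) * z ≡ f * (b * y * z)
      regroup = solve-∀

  Dpoly≡Dformula : ∀ t → Dpoly k n t ≡ Dformula k n t
  Dpoly≡Dformula t = begin
    Dpoly k n t
      ≡⟨ Dpoly-factorised t ⟩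
    r ℚ.* ℕtoℚ (K ! * (H * leadingFactor t))
      ≡⟨ cong₂ (λ u v → ratio 1 u ℚ.* ℕtoℚ v) n-1!≡U*V (regroup (K !) H (a !) (binomial (t + a) a)) ⟩
    ratio 1 (U * V) ℚ.* ℕtoℚ (V * (binomial (t + a) a * H))
      ≡⟨ ratio-*-cancel-common U V _ U>0 V>0 ⟩
    ratio 1 U ℚ.* ℕtoℚ (binomial (t + a) a * H)
      ≡⟨ cong (ratio 1 U ℚ.*_) (ℕtoℚ-* (binomial (t + a) a) H) ⟩
    ratio 1 U ℚ.* (ℕtoℚ (binomial (t + a) a) ℚ.* ℕtoℚ H)
      ≡⟨ cong₂ (λ u v → ratio 1 U ℚ.* (ℕtoℚ u ℚ.* ℕtoℚ v)) (C≡binomial (t + a) a)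
           (sumℕ-cong k (λ j _ → cong (Bc j *_) (C≡binomial (t + j) j))) ⟨
    Dformula k n t ∎
    where
    open ≡-Reasoning
    H U V : ℕ
    H = rowFactor t
    U = (n ∸ 1) C (k ∸ 1)
    V = K ! * a !
    K+a≡n-1 : K + a ≡ n ∸ 1
    K+a≡n-1 = cong (λ z → K + z) a≡1+A
    n-1!≡U*V : (n ∸ 1) ! ≡ U * V
    n-1!≡U*V = trans (cong _! (sym K+a≡n-1)) (trans (sym (binomial*factorials K a))
                 (cong (_* V) (trans (cong (λ z → binomial z K) K+a≡n-1) (sym (C≡binomial (n ∸ 1) K)))))
    U>0 : 0 < U
    U>0 = subst (0 <_) (sym (C≡binomial (n ∸ 1) K)) (binomial-pos (n ∸ 1) K (ℕP.m≤m+n K (suc A)))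
    V>0 : 0 < V
    V>0 = *-pos (ℕP.1≤n! K) (ℕP.1≤n! a)
    regroup : ∀ f h g b → f * (h * (g * b)) ≡ (f * g) * (b * h)
    regroup = solve-∀

  -- For m ≤ n−k the summand j = ℓ = 0 of d_{k,n,m} is positive, and for
  -- m > n−k the summand j = k−1, ℓ = m−(n−k) is.
  dcoeff-pos : ∀ m → m < n → 0ℚ ℚ.< dcoeff k n m
  dcoeff-pos m m<n with ℕP.≤-<-connex m a
  ... | inj₁ m≤a = positive-summand m 0 0 (s≤s z≤n) (s≤s z≤n)
        (*-pos {f 0 0} {shiftedCoeff g m 0} (*-pos {Bc 0} {stirling1 1 1} (Bc-pos 0) (s≤s z≤n))
          (subst (λ b → 0 < (if b then g (m ∸ 0) else 0)) (sym (≤ᵇ-true {0} {m} z≤n))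
            (subst₂ (λ u v → 0 < stirling1 u v) (ℕP.+-comm 1 a) (ℕP.+-comm 1 m) (stirling1-pos a m m≤a))))
  ... | inj₂ a<m = positive-summand m K l (ℕP.n<1+n K) (s≤s l≤K)
        (*-pos {f K l} {shiftedCoeff g m l} (*-pos (Bc-pos K) (stirling1-pos K l l≤K))
          (subst (λ b → 0 < (if b then g (m ∸ l) else 0)) (sym (≤ᵇ-true {l} {m} (ℕP.m∸n≤m m a)))
            (subst (λ z → 0 < stirling1 (a + 1) (z + 1)) (sym m∸l≡a)
              (subst (0 <_) (sym (stirling1-n-n (a + 1))) (s≤s z≤n)))))
    where
    l : ℕ
    l = m ∸ a
    m∸l≡a : m ∸ l ≡ a
    m∸l≡a = ℕP.m∸[m∸n]≡n (ℕP.<⇒≤ a<m)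
    l≤K : l ≤ K
    l≤K = ℕP.≤-pred (subst (l <_) (ℕP.m+n∸n≡m k a)
            (ℕP.∸-monoˡ-< (subst (m <_) (sym (ℕP.m+[n∸m]≡n k≤n)) m<n) (ℕP.<⇒≤ a<m)))

  diagonalSum≡Dformula : ∀ t → ℕtoℚ (diagonalSum A K t) ≡ Dformula k n t
  diagonalSum≡Dformula t = sym (begin
    ratio 1 ((n ∸ 1) C K) ℚ.* (ℕtoℚ ((t + a) C a) ℚ.* ℕtoℚ E)
      ≡⟨ cong₂ (λ u v → ratio 1 u ℚ.* v) (C≡binomial (n ∸ 1) K) (sym (ℕtoℚ-* ((t + a) C a) E)) ⟩
    ratio 1 U ℚ.* ℕtoℚ (((t + a) C a) * E)
      ≡⟨ cong (λ z → ratio 1 U ℚ.* ℕtoℚ z) (cong₂ _*_ leading-binomial E≡ehrhartSum) ⟩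
    ratio 1 U ℚ.* ℕtoℚ (binomial (t + suc A) (suc A) * ehrhartSum A K t)
      ≡⟨ cong (λ z → ratio 1 U ℚ.* ℕtoℚ z) (diagonalSum-closedForm A K t) ⟨
    ratio 1 U ℚ.* ℕtoℚ (U * diagonalSum A K t)
      ≡⟨ ratio-*-cancelʳ 1 U (diagonalSum A K t) (binomial-pos (K + suc A) K (ℕP.m≤m+n K (suc A))) ⟩
    ℕtoℚ (1 * diagonalSum A K t)
      ≡⟨ cong ℕtoℚ (ℕP.*-identityˡ (diagonalSum A K t)) ⟩
    ℕtoℚ (diagonalSum A K t) ∎)
    where
    open ≡-Reasoning
    U E : ℕ
    U = binomial (K + suc A) K
    E = sumℕ k (λ j → ((a ∸ 1 + j) C j) * ((t + j) C j))
    leading-binomial : (t + a) C a ≡ binomial (t + suc A) (suc A)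
    leading-binomial = trans (C≡binomial (t + a) a) (cong (λ z → binomial (t + z) z) a≡1+A)
    E≡ehrhartSum : E ≡ ehrhartSum A K t
    E≡ehrhartSum = sumℕ-cong k (λ j _ → cong₂ _*_
      (trans (C≡binomial (a ∸ 1 + j) j) (cong (λ z → binomial (z ∸ 1 + j) j) a≡1+A)) (C≡binomial (t + j) j))

incrementHead : ∀ {m} → Vec ℕ (suc m) → Vec ℕ (suc m)
incrementHead (x ∷ xs) = suc x ∷ xs

compositions : (m s : ℕ) → List (Vec ℕ m)
compositions zero    zero    = [] ∷ []
compositions zero    (suc s) = []
compositions (suc m) zero    = map (0 ∷_) (compositions m zero)
compositions (suc m) (suc s) = map (0 ∷_) (compositions m (suc s)) L.++ map incrementHead (compositions (suc m) s)

compositions-sound : ∀ m s {v} → v ∈ compositions m s → V.sum v ≡ s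
compositions-sound zero    zero    {[]} _ = refl
compositions-sound (suc m) zero    v∈ with ∈-map⁻ (0 ∷_) v∈
... | w , w∈ , refl = compositions-sound m zero w∈
compositions-sound (suc m) (suc s) v∈ with ∈-++⁻ (map (0 ∷_) (compositions m (suc s))) v∈
... | inj₁ v∈₁ with ∈-map⁻ (0 ∷_) v∈₁
...   | w , w∈ , refl = compositions-sound m (suc s) w∈
compositions-sound (suc m) (suc s) v∈ | inj₂ v∈₂ with ∈-map⁻ incrementHead v∈₂
...   | (x ∷ w) , w∈ , refl = cong suc (compositions-sound (suc m) s w∈)

∈-compositions : ∀ m s (v : Vec ℕ m) → V.sum v ≡ s → v ∈ compositions m s
∈-compositions zero    zero    []           _ = here refl
∈-compositions (suc m) zero    (zero ∷ w)   e = ∈-map⁺ (0 ∷_) (∈-compositions m zero w e)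
∈-compositions (suc m) (suc s) (zero ∷ w)   e = ∈-++⁺ˡ (∈-map⁺ (0 ∷_) (∈-compositions m (suc s) w e))
∈-compositions (suc m) (suc s) (suc x ∷ w) e = ∈-++⁺ʳ (map (0 ∷_) (compositions m (suc s)))
  (∈-map⁺ incrementHead (∈-compositions (suc m) s (x ∷ w) (ℕP.suc-injective e)))

compositions-unique : ∀ m s → Unique (compositions m s)
compositions-unique zero    zero    = [] AllPairs.∷ AllPairs.[]
compositions-unique zero    (suc s) = AllPairs.[]
compositions-unique (suc m) zero    = Unique.map⁺ VP.∷-injectiveʳ (compositions-unique m zero)
compositions-unique (suc m) (suc s) = Unique.++⁺
  (Unique.map⁺ VP.∷-injectiveʳ (compositions-unique m (suc s)))
  (Unique.map⁺ incrementHead-injective (compositions-unique (suc m) s))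
  head-zero-or-not
  where
  incrementHead-injective : ∀ {u v : Vec ℕ (suc m)} → incrementHead u ≡ incrementHead v → u ≡ v
  incrementHead-injective {x ∷ u} {y ∷ v} refl = refl
  head-zero-or-not : ∀ {v} → v ∈ map (0 ∷_) (compositions m (suc s)) × v ∈ map incrementHead (compositions (suc m) s) → ⊥
  head-zero-or-not (v∈₁ , v∈₂) with ∈-map⁻ (0 ∷_) v∈₁ | ∈-map⁻ incrementHead v∈₂
  ... | w , _ , refl | (x ∷ u) , _ , ()

length-compositions : ∀ m s → length (compositions (suc m) s) ≡ binomial (s + m) m
length-compositions zero zero = refl
length-compositions zero (suc s) =
  trans (LP.length-map incrementHead (compositions 1 s)) (trans (length-compositions zero s) (binomial-n-0 (s + 0)))
length-compositions (suc m) zero =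
  trans (LP.length-map (0 ∷_) (compositions (suc m) zero))
        (trans (length-compositions m zero) (trans (binomial-n-n m) (sym (binomial-n-n (suc m)))))
length-compositions (suc m) (suc s) = begin
  length (map (0 ∷_) (compositions (suc m) (suc s)) L.++ map incrementHead (compositions (suc (suc m)) s))
    ≡⟨ LP.length-++ (map (0 ∷_) (compositions (suc m) (suc s))) ⟩
  length (map (0 ∷_) (compositions (suc m) (suc s))) + length (map incrementHead (compositions (suc (suc m)) s))
    ≡⟨ cong₂ _+_ (LP.length-map (0 ∷_) (compositions (suc m) (suc s))) (LP.length-map incrementHead (compositions (suc (suc m)) s)) ⟩
  length (compositions (suc m) (suc s)) + length (compositions (suc (suc m)) s)
    ≡⟨ cong₂ _+_ (trans (length-compositions m (suc s)) (cong (λ z → binomial z m) (sym (ℕP.+-suc s m))))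
                 (length-compositions (suc m) s) ⟩
  binomial (suc s + suc m) (suc m) ∎
  where open ≡-Reasoning

length-cartesianProduct : ∀ {A B : Set} (xs : List A) (ys : List B) →
  length (cartesianProduct xs ys) ≡ length xs * length ys
length-cartesianProduct []       ys = refl
length-cartesianProduct (x ∷ xs) ys = trans (LP.length-++ (map (x ,_) ys))
  (cong₂ _+_ (LP.length-map (x ,_) ys) (length-cartesianProduct xs ys))

module _ (k a : ℕ) where

  equalSumPairs : ℕ → List (Vec ℕ k × Vec ℕ a)
  equalSumPairs s = cartesianProduct (compositions k s) (compositions a s)

  equalSumPairsUpTo : ℕ → List (Vec ℕ k × Vec ℕ a)
  equalSumPairsUpTo zero    = equalSumPairs 0
  equalSumPairsUpTo (suc t) = equalSumPairsUpTo t L.++ equalSumPairs (suc t)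

  private
    equalSumPairs-sound : ∀ s {p : Vec ℕ k × Vec ℕ a} → p ∈ equalSumPairs s →
      V.sum (proj₁ p) ≡ s × V.sum (proj₂ p) ≡ s
    equalSumPairs-sound s p∈ with ∈-cartesianProduct⁻ (compositions k s) (compositions a s) p∈
    ... | d∈ , c∈ = compositions-sound k s d∈ , compositions-sound a s c∈

    equalSumPairs-unique : ∀ s → Unique (equalSumPairs s)
    equalSumPairs-unique s = Unique.cartesianProduct⁺ (compositions-unique k s) (compositions-unique a s)

  equalSumPairsUpTo-sound : ∀ t {p : Vec ℕ k × Vec ℕ a} → p ∈ equalSumPairsUpTo t →
    V.sum (proj₁ p) ≡ V.sum (proj₂ p) × V.sum (proj₂ p) ≤ t
  equalSumPairsUpTo-sound zero p∈ with equalSumPairs-sound 0 p∈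
  ... | d≡0 , c≡0 = trans d≡0 (sym c≡0) , ℕP.≤-reflexive c≡0
  equalSumPairsUpTo-sound (suc t) p∈ with ∈-++⁻ (equalSumPairsUpTo t) p∈
  ... | inj₁ p∈₁ with equalSumPairsUpTo-sound t p∈₁
  ...   | d≡c , c≤t = d≡c , ℕP.m≤n⇒m≤1+n c≤t
  equalSumPairsUpTo-sound (suc t) p∈ | inj₂ p∈₂ with equalSumPairs-sound (suc t) p∈₂
  ...   | d≡s , c≡s = trans d≡s (sym c≡s) , ℕP.≤-reflexive c≡s

  ∈-equalSumPairsUpTo : ∀ t (d : Vec ℕ k) (c : Vec ℕ a) → V.sum d ≡ V.sum c → V.sum c ≤ t →
    (d , c) ∈ equalSumPairsUpTo t
  ∈-equalSumPairsUpTo zero d c d≡c c≤0 = ∈-cartesianProduct⁺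
    (∈-compositions k 0 d (trans d≡c (ℕP.n≤0⇒n≡0 c≤0))) (∈-compositions a 0 c (ℕP.n≤0⇒n≡0 c≤0))
  ∈-equalSumPairsUpTo (suc t) d c d≡c c≤1+t with ℕP.m≤n⇒m<n∨m≡n c≤1+t
  ... | inj₁ c<1+t = ∈-++⁺ˡ (∈-equalSumPairsUpTo t d c d≡c (ℕP.≤-pred c<1+t))
  ... | inj₂ c≡1+t = ∈-++⁺ʳ (equalSumPairsUpTo t)
    (∈-cartesianProduct⁺ (∈-compositions k (suc t) d (trans d≡c c≡1+t)) (∈-compositions a (suc t) c c≡1+t))

  equalSumPairsUpTo-unique : ∀ t → Unique (equalSumPairsUpTo t)
  equalSumPairsUpTo-unique zero    = equalSumPairs-unique 0
  equalSumPairsUpTo-unique (suc t) = Unique.++⁺ (equalSumPairsUpTo-unique t) (equalSumPairs-unique (suc t)) disjoint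
    where
    disjoint : ∀ {p} → p ∈ equalSumPairsUpTo t × p ∈ equalSumPairs (suc t) → ⊥
    disjoint (p∈₁ , p∈₂) with equalSumPairsUpTo-sound t p∈₁ | equalSumPairs-sound (suc t) p∈₂
    ... | _ , c≤t | _ , c≡1+t = ℕP.<⇒≱ (ℕP.n<1+n t) (subst (_≤ t) c≡1+t c≤t)

  length-equalSumPairsUpTo : ∀ t → length (equalSumPairsUpTo t) ≡
    sumℕ (suc t) (λ s → length (compositions k s) * length (compositions a s))
  length-equalSumPairsUpTo zero    = length-cartesianProduct (compositions k 0) (compositions a 0)
  length-equalSumPairsUpTo (suc t) = trans (LP.length-++ (equalSumPairsUpTo t))
    (cong₂ _+_ (length-equalSumPairsUpTo t) (length-cartesianProduct (compositions k (suc t)) (compositions a (suc t))))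

∣p++q∣≡∣p∣+∣q∣ : ∀ {m l} (p : Subset m) (q : Subset l) → ∣ p ++ q ∣ ≡ ∣ p ∣ + ∣ q ∣
∣p++q∣≡∣p∣+∣q∣ []          q = refl
∣p++q∣≡∣p∣+∣q∣ (true ∷ p)  q = cong suc (∣p++q∣≡∣p∣+∣q∣ p q)
∣p++q∣≡∣p∣+∣q∣ (false ∷ p) q = ∣p++q∣≡∣p∣+∣q∣ p q

allBut : ∀ {m} → Fin m → Subset m
allBut F.zero    = false ∷ ⊤
allBut (F.suc i) = true ∷ allBut i

1+∣allBut∣ : ∀ {m} (i : Fin m) → suc ∣ allBut i ∣ ≡ m
1+∣allBut∣ {suc m} F.zero = cong suc (∣⊤∣≡n m)
1+∣allBut∣ (F.suc i)      = cong suc (1+∣allBut∣ i)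

lookup-allBut-≡ : ∀ {m} (i : Fin m) → lookup (allBut i) i ≡ false
lookup-allBut-≡ F.zero    = refl
lookup-allBut-≡ (F.suc i) = lookup-allBut-≡ i

lookup-allBut-≢ : ∀ {m} (i j : Fin m) → j ≢ i → lookup (allBut i) j ≡ true
lookup-allBut-≢ F.zero    F.zero    j≢i = ⊥-elim (j≢i refl)
lookup-allBut-≢ F.zero    (F.suc j) _   = VP.lookup-replicate j true
lookup-allBut-≢ (F.suc i) F.zero    _   = refl
lookup-allBut-≢ (F.suc i) (F.suc j) j≢i = lookup-allBut-≢ i j (λ j≡i → j≢i (cong F.suc j≡i))

lookup-⁅⁆-≢ : ∀ {m} (i j : Fin m) → j ≢ i → lookup ⁅ i ⁆ j ≡ false
lookup-⁅⁆-≢ F.zero    F.zero    j≢i = ⊥-elim (j≢i refl)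
lookup-⁅⁆-≢ F.zero    (F.suc j) _   = VP.lookup-replicate j false
lookup-⁅⁆-≢ (F.suc i) F.zero    _   = refl
lookup-⁅⁆-≢ (F.suc i) (F.suc j) j≢i = lookup-⁅⁆-≢ i j (λ j≡i → j≢i (cong F.suc j≡i))

∃-outside : ∀ {m} (p : Subset m) → ∣ p ∣ < m → Σ (Fin m) λ i → lookup p i ≡ false
∃-outside (true ∷ p) (s≤s ∣p∣<m) with ∃-outside p ∣p∣<m
... | i , p[i]≡false = F.suc i , p[i]≡false
∃-outside (false ∷ p) _ = F.zero , refl

∃-two-outside : ∀ {m} (p : Subset m) → suc ∣ p ∣ < m →
  Σ (Fin m) λ i → Σ (Fin m) λ j → toℕ i < toℕ j × lookup p i ≡ false × lookup p j ≡ false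
∃-two-outside (true ∷ p) (s≤s 1+∣p∣<m) with ∃-two-outside p 1+∣p∣<m
... | i , j , i<j , p[i]≡false , p[j]≡false = F.suc i , F.suc j , s≤s i<j , p[i]≡false , p[j]≡false
∃-two-outside (false ∷ p) (s≤s 1+∣p∣<m) with ∃-outside p 1+∣p∣<m
... | j , p[j]≡false = F.zero , F.suc j , s≤s z≤n , refl , p[j]≡false

-- Spanning trees of the graph of T_{k,n}, with n = k + a: the edges 0,…,k−1
-- form the path 0 − 1 − ⋯ − k and the a remaining edges are parallel edges k − 0.

module Bases (k a : ℕ) where

  n : ℕ
  n = k + a

  private
    endpoints-path : (e : Fin n) → toℕ e < k → endpoints k e ≡ (toℕ e , suc (toℕ e))
    endpoints-path e e<k = cong (λ b → if b then (toℕ e , suc (toℕ e)) else (k , 0)) (Equivalence.to T-≡ (ℕP.<⇒<ᵇ e<k))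

    endpoints-parallel : (e : Fin n) → ¬ (toℕ e < k) → endpoints k e ≡ (k , 0)
    endpoints-parallel e e≮k = cong (λ b → if b then (toℕ e , suc (toℕ e)) else (k , 0))
      (¬T⇒≡false (λ h → e≮k (ℕP.<ᵇ⇒< (toℕ e) k h)))

    pathEdge : ∀ v → v < k → Fin n
    pathEdge v v<k = fromℕ< v<k ↑ˡ a

    toℕ-pathEdge : ∀ v (v<k : v < k) → toℕ (pathEdge v v<k) ≡ v
    toℕ-pathEdge v v<k = trans (FP.toℕ-↑ˡ (fromℕ< v<k) a) (FP.toℕ-fromℕ< v<k)

    endpoints-pathEdge : ∀ v (v<k : v < k) → endpoints k (pathEdge v v<k) ≡ (v , suc v)
    endpoints-pathEdge v v<k = trans (endpoints-path (pathEdge v v<k) (subst (_< k) (sym (toℕ-pathEdge v v<k)) v<k))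
                                     (cong (λ z → z , suc z) (toℕ-pathEdge v v<k))

    reach-forward : ∀ {B : Subset n} {u} v (v<k : v < k) → lookup B (pathEdge v v<k) ≡ true →
      Reach k B u v → Reach k B u (suc v)
    reach-forward {B} {u} v v<k e∈B r = subst (Reach k B u) (cong proj₂ (endpoints-pathEdge v v<k))
      (fwd (pathEdge v v<k) (VP.lookup⇒[]= _ B e∈B) (subst (Reach k B u) (sym (cong proj₁ (endpoints-pathEdge v v<k))) r))

    reach-backward : ∀ {B : Subset n} {u} v (v<k : v < k) → lookup B (pathEdge v v<k) ≡ true →
      Reach k B u (suc v) → Reach k B u v
    reach-backward {B} {u} v v<k e∈B r = subst (Reach k B u) (cong proj₁ (endpoints-pathEdge v v<k))
      (bwd (pathEdge v v<k) (VP.lookup⇒[]= _ B e∈B) (subst (Reach k B u) (sym (cong proj₂ (endpoints-pathEdge v v<k))) r))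

    reach-parallel : ∀ {B : Subset n} {u} (p : Fin a) → lookup B (k ↑ʳ p) ≡ true →
      Reach k B u 0 → Reach k B u k
    reach-parallel {B} {u} p e∈B r = subst (Reach k B u) (cong proj₁ (endpoints-parallel e e≮k))
      (bwd e (VP.lookup⇒[]= e B e∈B) (subst (Reach k B u) (sym (cong proj₂ (endpoints-parallel e e≮k))) r))
      where
      e : Fin n
      e = k ↑ʳ p
      e≮k : ¬ (toℕ e < k)
      e≮k e<k = ℕP.<⇒≱ e<k (subst (k ≤_) (sym (FP.toℕ-↑ʳ k p)) (ℕP.m≤m+n k (toℕ p)))

  pathBasis : Subset n
  pathBasis = ⊤ {k} ++ ∅ {a}

  pathBasis-isBasis : IsBasisT k n pathBasis
  pathBasis-isBasis = size , reach
    where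
    size : ∣ pathBasis ∣ ≡ k
    size = trans (∣p++q∣≡∣p∣+∣q∣ (⊤ {k}) (∅ {a})) (trans (cong₂ _+_ (∣⊤∣≡n k) (∣⊥∣≡0 a)) (ℕP.+-identityʳ k))
    reach : ∀ v → v ≤ k → Reach k pathBasis 0 v
    reach zero    _   = here
    reach (suc v) v<k = reach-forward v v<k
      (trans (VP.lookup-++ˡ (⊤ {k}) (∅ {a}) (fromℕ< v<k)) (VP.lookup-replicate (fromℕ< v<k) true)) (reach v (ℕP.<⇒≤ v<k))

  -- The path with edge i replaced by the parallel edge p.
  swapBasis : Fin k → Fin a → Subset n
  swapBasis i p = allBut i ++ ⁅ p ⁆

  swapBasis-isBasis : ∀ i p → IsBasisT k n (swapBasis i p)
  swapBasis-isBasis i p = size , reach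
    where
    B : Subset n
    B = swapBasis i p
    size : ∣ B ∣ ≡ k
    size = trans (∣p++q∣≡∣p∣+∣q∣ (allBut i) ⁅ p ⁆)
             (trans (cong (λ z → ∣ allBut i ∣ + z) (∣⁅x⁆∣≡1 p)) (trans (ℕP.+-comm _ 1) (1+∣allBut∣ i)))
    pathEdge∈B : ∀ v (v<k : v < k) → v ≢ toℕ i → lookup B (pathEdge v v<k) ≡ true
    pathEdge∈B v v<k v≢i = trans (VP.lookup-++ˡ (allBut i) ⁅ p ⁆ (fromℕ< v<k))
      (lookup-allBut-≢ i (fromℕ< v<k) (λ e → v≢i (trans (sym (FP.toℕ-fromℕ< v<k)) (cong toℕ e))))
    below : ∀ v → v ≤ toℕ i → Reach k B 0 v
    below zero    _     = here
    below (suc v) v<i = reach-forward v v<k (pathEdge∈B v v<k (λ v≡i → ℕP.<-irrefl v≡i v<i)) (below v (ℕP.<⇒≤ v<i))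
      where v<k = ℕP.<-≤-trans v<i (ℕP.<⇒≤ (FP.toℕ<n i))
    -- vertex k is reached through the parallel edge p, and then k − d by walking back
    above : ∀ d → toℕ i < k ∸ d → Reach k B 0 (k ∸ d)
    above zero    _       = reach-parallel p (trans (VP.lookup-++ʳ (allBut i) ⁅ p ⁆ p) (VP.[]=⇒lookup (x∈⁅x⁆ p))) here
    above (suc d) i<k∸1+d = reach-backward w w<k (pathEdge∈B w w<k (λ w≡i → ℕP.<-irrefl (sym w≡i) i<k∸1+d))
      (subst (Reach k B 0) (sym 1+w≡k∸d) (above d (subst (toℕ i <_) 1+w≡k∸d (ℕP.m<n⇒m<1+n i<k∸1+d))))
      where
      w : ℕ
      w = k ∸ suc d
      1+d≤k : suc d ≤ k
      1+d≤k = ℕP.<⇒≤ (ℕP.m∸n≢0⇒n<m (ℕP.n>0⇒n≢0 (ℕP.≤-trans (s≤s z≤n) i<k∸1+d)))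
      1+w≡k∸d : suc w ≡ k ∸ d
      1+w≡k∸d = sym (ℕP.+-∸-assoc 1 1+d≤k)
      w<k : w < k
      w<k = subst (_≤ k) (sym 1+w≡k∸d) (ℕP.m∸n≤m k d)
    reach : ∀ v → v ≤ k → Reach k B 0 v
    reach v v≤k with ℕP.≤-<-connex v (toℕ i)
    ... | inj₁ v≤i = below v v≤i
    ... | inj₂ i<v = subst (Reach k B 0) (ℕP.m∸[m∸n]≡n v≤k)
                       (above (k ∸ v) (subst (toℕ i <_) (sym (ℕP.m∸[m∸n]≡n v≤k)) i<v))

  -- If the path edges i < j are both missing from B, every vertex reachable
  -- from 0 lies in [0, i] or in (j, k]: the parallel edges only join k and 0.
  private
    module TwoMissing (xs : Subset k) (ys : Subset a) (i j : Fin k) (i<j : toℕ i < toℕ j)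
                      (i∉ : lookup xs i ≡ false) (j∉ : lookup xs j ≡ false) where
      B = xs ++ ys

      Outside : ℕ → Set
      Outside v = v ≤ toℕ i ⊎ toℕ j < v

      edge-not-missing : ∀ (e : Fin n) (c : Fin k) → lookup xs c ≡ false → e ∈ₛ B → toℕ e ≢ toℕ c
      edge-not-missing e c c∉ e∈B toℕe≡toℕc with trans (sym (VP.[]=⇒lookup e∈B))
        (trans (cong (lookup B) (FP.toℕ-injective (trans toℕe≡toℕc (sym (FP.toℕ-↑ˡ c a)))))
               (trans (VP.lookup-++ˡ xs ys c) c∉))
      ... | ()

      outside-forward : ∀ v → v ≢ toℕ i → Outside v → Outside (suc v)
      outside-forward v v≢i (inj₁ v≤i) = inj₁ (ℕP.≤∧≢⇒< v≤i v≢i)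
      outside-forward v v≢i (inj₂ j<v) = inj₂ (ℕP.m<n⇒m<1+n j<v)

      outside-backward : ∀ v → v ≢ toℕ j → Outside (suc v) → Outside v
      outside-backward v v≢j (inj₁ 1+v≤i) = inj₁ (ℕP.<⇒≤ 1+v≤i)
      outside-backward v v≢j (inj₂ j<1+v) = inj₂ (ℕP.≤∧≢⇒< (ℕP.≤-pred j<1+v) (λ j≡v → v≢j (sym j≡v)))

      reachable-outside : ∀ {v} → Reach k B 0 v → Outside v
      reachable-outside here = inj₁ z≤n
      reachable-outside (fwd e e∈B r) with toℕ e ℕP.<? k
      ... | yes e<k = subst Outside (sym (cong proj₂ (endpoints-path e e<k)))
            (outside-forward (toℕ e) (edge-not-missing e i i∉ e∈B)
              (subst Outside (cong proj₁ (endpoints-path e e<k)) (reachable-outside r)))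
      ... | no e≮k = subst Outside (sym (cong proj₂ (endpoints-parallel e e≮k))) (inj₁ z≤n)
      reachable-outside (bwd e e∈B r) with toℕ e ℕP.<? k
      ... | yes e<k = subst Outside (sym (cong proj₁ (endpoints-path e e<k)))
            (outside-backward (toℕ e) (edge-not-missing e j j∉ e∈B)
              (subst Outside (cong proj₂ (endpoints-path e e<k)) (reachable-outside r)))
      ... | no e≮k = subst Outside (sym (cong proj₁ (endpoints-parallel e e≮k))) (inj₂ (FP.toℕ<n j))

      unreachable : ¬ Reach k B 0 (suc (toℕ i))
      unreachable r with reachable-outside r
      ... | inj₁ 1+i≤i = ℕP.<-irrefl refl 1+i≤i
      ... | inj₂ j<1+i = ℕP.<⇒≱ i<j (ℕP.≤-pred j<1+i)

  atMostOneParallel : ∀ (xs : Subset k) (ys : Subset a) → IsBasisT k n (xs ++ ys) → ∣ ys ∣ ≤ 1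
  atMostOneParallel xs ys (size , reach) with ∣ ys ∣ ℕP.≤? 1
  ... | yes ∣ys∣≤1 = ∣ys∣≤1
  ... | no ∣ys∣≰1 with ∃-two-outside xs two-missing
    where
    two-missing : suc ∣ xs ∣ < k
    two-missing = ℕP.<-≤-trans
      (subst (_< ∣ xs ∣ + ∣ ys ∣) (ℕP.+-comm ∣ xs ∣ 1) (ℕP.+-monoʳ-< ∣ xs ∣ (ℕP.≰⇒> ∣ys∣≰1)))
      (ℕP.≤-reflexive (trans (sym (∣p++q∣≡∣p∣+∣q∣ xs ys)) size))
  ... | i , j , i<j , i∉ , j∉ = ⊥-elim (TwoMissing.unreachable xs ys i j i<j i∉ j∉
          (reach (suc (toℕ i)) (ℕP.<-trans i<j (FP.toℕ<n j))))

sum≡0⇒lookup≡0 : ∀ {m} (v : Vec ℕ m) → V.sum v ≡ 0 → ∀ i → lookup v i ≡ 0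
sum≡0⇒lookup≡0 (x ∷ v) e F.zero    = ℕP.m+n≡0⇒m≡0 x e
sum≡0⇒lookup≡0 (x ∷ v) e (F.suc i) = sum≡0⇒lookup≡0 v (ℕP.m+n≡0⇒n≡0 x e) i

Decrement : ∀ {m} → Vec ℕ m → Fin m → Vec ℕ m → Set
Decrement v i v′ = lookup v i ≡ suc (lookup v′ i) × (∀ j → j ≢ i → lookup v j ≡ lookup v′ j)

decrement : ∀ {m} (v : Vec ℕ m) s → V.sum v ≡ suc s →
  Σ (Fin m) λ i → Σ (Vec ℕ m) λ v′ → V.sum v′ ≡ s × Decrement v i v′
decrement (suc x ∷ v) s e = F.zero , (x ∷ v) , ℕP.suc-injective e , refl , others
  where others : ∀ j → j ≢ F.zero → lookup (suc x ∷ v) j ≡ lookup (x ∷ v) j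
        others F.zero    j≢0 = ⊥-elim (j≢0 refl)
        others (F.suc j) _   = refl
decrement (zero ∷ v) s e with decrement v s e
... | i , v′ , e′ , v[i]≡1+v′[i] , others = F.suc i , (0 ∷ v′) , e′ , v[i]≡1+v′[i] , others′
  where others′ : ∀ j → j ≢ F.suc i → lookup (0 ∷ v) j ≡ lookup (0 ∷ v′) j
        others′ F.zero    _   = refl
        others′ (F.suc j) j≢i = others j (λ j≡i → j≢i (cong F.suc j≡i))

lookup-extensionality : ∀ {A : Set} {m} {xs ys : Vec A m} → (∀ i → lookup xs i ≡ lookup ys i) → xs ≡ ys
lookup-extensionality {xs = xs} {ys} xs≗ys =
  trans (sym (VP.tabulate∘lookup xs)) (trans (VP.tabulate-cong xs≗ys) (VP.tabulate∘lookup ys))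

↑-induction : ∀ k a (P : Fin (k + a) → Set) → (∀ j → P (j ↑ˡ a)) → (∀ q → P (k ↑ʳ q)) → ∀ e → P e
↑-induction k a P left right e with F.splitAt k e in eq
... | inj₁ j = subst P (FP.splitAt⁻¹-↑ˡ eq) (left j)
... | inj₂ q = subst P (FP.splitAt⁻¹-↑ʳ eq) (right q)

indicatorℤ : ∀ {n} → Subset n → Fin n → ℤ
indicatorℤ B e = if lookup B e then + 1 else + 0

ℤtoℚ-indicatorℤ : ∀ {n} (B : Subset n) e → ℤtoℚ (indicatorℤ B e) ≡ indicator B e
ℤtoℚ-indicatorℤ B e with lookup B e
... | true  = refl
... | false = refl

+[1+t]-+[1+d] : ∀ t d → + suc t ℤ.- + suc d ≡ + t ℤ.- + d
+[1+t]-+[1+d] t d = trans (ℤP.m-n≡m⊖n (suc t) (suc d)) (trans (ℤP.[1+m]⊖[1+n]≡m⊖n t d) (sym (ℤP.m-n≡m⊖n t d)))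

+[1+t]-+d : ∀ t d → + suc t ℤ.- + d ≡ (+ t ℤ.- + d) ℤ.+ + 1
+[1+t]-+d t d = shuffle (+ t) (+ d)
  where shuffle : ∀ T D → (+ 1 ℤ.+ T) ℤ.- D ≡ (T ℤ.- D) ℤ.+ + 1
        shuffle = ℤ-Solver.solve-∀

sumFin : (m : ℕ) → (Fin m → ℚ) → ℚ
sumFin zero    f = 0ℚ
sumFin (suc m) f = f F.zero ℚ.+ sumFin m (λ i → f (F.suc i))

sumFin-cong : ∀ m {f g : Fin m → ℚ} → (∀ i → f i ≡ g i) → sumFin m f ≡ sumFin m g
sumFin-cong zero    f≗g = refl
sumFin-cong (suc m) f≗g = cong₂ ℚ._+_ (f≗g F.zero) (sumFin-cong m (λ i → f≗g (F.suc i)))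

sumFin-↑ : ∀ k a (f : Fin (k + a) → ℚ) → sumFin (k + a) f ≡ sumFin k (λ j → f (j ↑ˡ a)) ℚ.+ sumFin a (λ q → f (k ↑ʳ q))
sumFin-↑ zero    a f = sym (ℚP.+-identityˡ _)
sumFin-↑ (suc k) a f = trans (cong (f F.zero ℚ.+_) (sumFin-↑ k a (λ i → f (F.suc i)))) (sym (ℚP.+-assoc (f F.zero) _ _))

sumFin-indicator : ∀ {m} (p : Subset m) → sumFin m (indicator p) ≡ ℕtoℚ ∣ p ∣
sumFin-indicator []          = refl
sumFin-indicator (true ∷ p)  = trans (cong (1ℚ ℚ.+_) (sumFin-indicator p)) (sym (ℕtoℚ-+ 1 ∣ p ∣))
sumFin-indicator (false ∷ p) = trans (ℚP.+-identityˡ _) (sumFin-indicator p)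

sumFin-ℕtoℚ : ∀ m (f : Fin m → ℕ) → sumFin m (λ i → ℕtoℚ (f i)) ≡ ℕtoℚ (V.sum (V.tabulate f))
sumFin-ℕtoℚ zero    f = refl
sumFin-ℕtoℚ (suc m) f = trans (cong (ℕtoℚ (f F.zero) ℚ.+_) (sumFin-ℕtoℚ m (λ i → f (F.suc i)))) (sym (ℕtoℚ-+ (f F.zero) _))

sum-tabulate-complement : ∀ m t (f g : Fin m → ℕ) → (∀ i → f i + g i ≡ t) →
  V.sum (V.tabulate f) + V.sum (V.tabulate g) ≡ m * t
sum-tabulate-complement zero    t f g f+g≡t = refl
sum-tabulate-complement (suc m) t f g f+g≡t = begin
  (f F.zero + V.sum (V.tabulate (λ i → f (F.suc i)))) + (g F.zero + V.sum (V.tabulate (λ i → g (F.suc i))))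
    ≡⟨ interchange (f F.zero) _ (g F.zero) _ ⟩
  (f F.zero + g F.zero) + (V.sum (V.tabulate (λ i → f (F.suc i))) + V.sum (V.tabulate (λ i → g (F.suc i))))
    ≡⟨ cong₂ _+_ (f+g≡t F.zero) (sum-tabulate-complement m t _ _ (λ i → f+g≡t (F.suc i))) ⟩
  t + m * t ∎
  where open ≡-Reasoning

InDilate-suc : ∀ {k n t} (x x′ : Vec ℤ n) (B : Subset n) → InDilate k n t x′ → IsBasisT k n B →
  (∀ e → lookup x e ≡ lookup x′ e ℤ.+ indicatorℤ B e) → InDilate k n (suc t) x
InDilate-suc {n = n} {t = t} x x′ B (L , bases , total , coords) B-basis x≡x′+B =
  ((B , 1ℚ) ∷ L) , ((B-basis , ℚP.nonNegative⁻¹ 1ℚ) ∷ bases) ,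
  trans (cong (1ℚ ℚ.+_) total) (sym (ℕtoℚ-+ 1 t)) , coords′
  where
  S : Fin n → ℚ
  S e = foldr (λ p s → proj₂ p ℚ.* indicator (proj₁ p) e ℚ.+ s) 0ℚ L
  coords′ : ∀ e → lookup x e ℚ./ 1 ≡ 1ℚ ℚ.* indicator B e ℚ.+ S e
  coords′ e = begin
    lookup x e ℚ./ 1                             ≡⟨ cong ℤtoℚ (x≡x′+B e) ⟩
    ℤtoℚ (lookup x′ e ℤ.+ indicatorℤ B e)        ≡⟨ ℤtoℚ-+ (lookup x′ e) (indicatorℤ B e) ⟩
    ℤtoℚ (lookup x′ e) ℚ.+ ℤtoℚ (indicatorℤ B e) ≡⟨ cong₂ ℚ._+_ (coords e) (ℤtoℚ-indicatorℤ B e) ⟩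
    S e ℚ.+ indicator B e                        ≡⟨ ℚP.+-comm (S e) (indicator B e) ⟩
    indicator B e ℚ.+ S e                        ≡⟨ cong (ℚ._+ S e) (ℚP.*-identityˡ (indicator B e)) ⟨
    1ℚ ℚ.* indicator B e ℚ.+ S e                 ∎
    where open ≡-Reasoning

module LatticePoints (k a : ℕ) where

  open Bases k a

  latticePoint : ℕ → Vec ℕ k → Vec ℕ a → Vec ℤ n
  latticePoint t d c = V.map (λ x → + t ℤ.- + x) d ++ V.map +_ c

  lookup-latticePoint-path : ∀ t d c j → lookup (latticePoint t d c) (j ↑ˡ a) ≡ + t ℤ.- + lookup d j
  lookup-latticePoint-path t d c j =
    trans (VP.lookup-++ˡ (V.map (λ x → + t ℤ.- + x) d) (V.map +_ c) j) (VP.lookup-map j _ d)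

  lookup-latticePoint-parallel : ∀ t d c q → lookup (latticePoint t d c) (k ↑ʳ q) ≡ + lookup c q
  lookup-latticePoint-parallel t d c q =
    trans (VP.lookup-++ʳ (V.map (λ x → + t ℤ.- + x) d) (V.map +_ c) q) (VP.lookup-map q _ c)

  private
    indicatorℤ-++ˡ : ∀ (xs : Subset k) (ys : Subset a) j → indicatorℤ (xs ++ ys) (j ↑ˡ a) ≡ indicatorℤ xs j
    indicatorℤ-++ˡ xs ys j = cong (λ b → if b then + 1 else + 0) (VP.lookup-++ˡ xs ys j)

    indicatorℤ-++ʳ : ∀ (xs : Subset k) (ys : Subset a) q → indicatorℤ (xs ++ ys) (k ↑ʳ q) ≡ indicatorℤ ys q
    indicatorℤ-++ʳ xs ys q = cong (λ b → if b then + 1 else + 0) (VP.lookup-++ʳ xs ys q)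

  latticePoint-suc-pathBasis : ∀ t d c e →
    lookup (latticePoint (suc t) d c) e ≡ lookup (latticePoint t d c) e ℤ.+ indicatorℤ pathBasis e
  latticePoint-suc-pathBasis t d c = ↑-induction k a Step path parallel
    where
    Step : Fin n → Set
    Step e = lookup (latticePoint (suc t) d c) e ≡ lookup (latticePoint t d c) e ℤ.+ indicatorℤ pathBasis e
    path : ∀ j → Step (j ↑ˡ a)
    path j = begin
      lookup (latticePoint (suc t) d c) (j ↑ˡ a)   ≡⟨ lookup-latticePoint-path (suc t) d c j ⟩
      + suc t ℤ.- + lookup d j                     ≡⟨ +[1+t]-+d t (lookup d j) ⟩
      (+ t ℤ.- + lookup d j) ℤ.+ + 1               ≡⟨ cong₂ ℤ._+_ (lookup-latticePoint-path t d c j)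
                                                        (trans (indicatorℤ-++ˡ ⊤ ∅ j)
                                                               (cong (λ b → if b then + 1 else + 0) (VP.lookup-replicate j true))) ⟨
      lookup (latticePoint t d c) (j ↑ˡ a) ℤ.+ indicatorℤ pathBasis (j ↑ˡ a) ∎
      where open ≡-Reasoning
    parallel : ∀ q → Step (k ↑ʳ q)
    parallel q = begin
      lookup (latticePoint (suc t) d c) (k ↑ʳ q)  ≡⟨ lookup-latticePoint-parallel (suc t) d c q ⟩
      + lookup c q                                ≡⟨ ℤP.+-identityʳ _ ⟨
      + lookup c q ℤ.+ + 0                        ≡⟨ cong₂ ℤ._+_ (lookup-latticePoint-parallel t d c q)
                                                        (trans (indicatorℤ-++ʳ ⊤ ∅ q)
                                                               (cong (λ b → if b then + 1 else + 0) (VP.lookup-replicate q false))) ⟨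
      lookup (latticePoint t d c) (k ↑ʳ q) ℤ.+ indicatorℤ pathBasis (k ↑ʳ q) ∎
      where open ≡-Reasoning

  latticePoint-suc-swapBasis : ∀ t d d′ c c′ {i p} → Decrement d i d′ → Decrement c p c′ → ∀ e →
    lookup (latticePoint (suc t) d c) e ≡ lookup (latticePoint t d′ c′) e ℤ.+ indicatorℤ (swapBasis i p) e
  latticePoint-suc-swapBasis t d d′ c c′ {i} {p} (d[i]≡ , d-others) (c[p]≡ , c-others) =
    ↑-induction k a Step path parallel
    where
    open ≡-Reasoning
    Step : Fin n → Set
    Step e = lookup (latticePoint (suc t) d c) e ≡ lookup (latticePoint t d′ c′) e ℤ.+ indicatorℤ (swapBasis i p) e
    path : ∀ j → Step (j ↑ˡ a)
    path j with j FP.≟ i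
    ... | yes refl = begin
      lookup (latticePoint (suc t) d c) (i ↑ˡ a)   ≡⟨ lookup-latticePoint-path (suc t) d c i ⟩
      + suc t ℤ.- + lookup d i                     ≡⟨ cong (λ z → + suc t ℤ.- + z) d[i]≡ ⟩
      + suc t ℤ.- + suc (lookup d′ i)              ≡⟨ +[1+t]-+[1+d] t (lookup d′ i) ⟩
      + t ℤ.- + lookup d′ i                        ≡⟨ ℤP.+-identityʳ _ ⟨
      (+ t ℤ.- + lookup d′ i) ℤ.+ + 0              ≡⟨ cong₂ ℤ._+_ (lookup-latticePoint-path t d′ c′ i)
                                                        (trans (indicatorℤ-++ˡ (allBut i) ⁅ p ⁆ i) (cong (λ b → if b then + 1 else + 0) (lookup-allBut-≡ i))) ⟨
      lookup (latticePoint t d′ c′) (i ↑ˡ a) ℤ.+ indicatorℤ (swapBasis i p) (i ↑ˡ a) ∎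
    ... | no j≢i = begin
      lookup (latticePoint (suc t) d c) (j ↑ˡ a)   ≡⟨ lookup-latticePoint-path (suc t) d c j ⟩
      + suc t ℤ.- + lookup d j                     ≡⟨ cong (λ z → + suc t ℤ.- + z) (d-others j j≢i) ⟩
      + suc t ℤ.- + lookup d′ j                    ≡⟨ +[1+t]-+d t (lookup d′ j) ⟩
      (+ t ℤ.- + lookup d′ j) ℤ.+ + 1              ≡⟨ cong₂ ℤ._+_ (lookup-latticePoint-path t d′ c′ j)
                                                        (trans (indicatorℤ-++ˡ (allBut i) ⁅ p ⁆ j) (cong (λ b → if b then + 1 else + 0) (lookup-allBut-≢ i j j≢i))) ⟨
      lookup (latticePoint t d′ c′) (j ↑ˡ a) ℤ.+ indicatorℤ (swapBasis i p) (j ↑ˡ a) ∎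
    parallel : ∀ q → Step (k ↑ʳ q)
    parallel q with q FP.≟ p
    ... | yes refl = begin
      lookup (latticePoint (suc t) d c) (k ↑ʳ p)   ≡⟨ lookup-latticePoint-parallel (suc t) d c p ⟩
      + lookup c p                                 ≡⟨ cong +_ (trans c[p]≡ (ℕP.+-comm 1 (lookup c′ p))) ⟩
      + (lookup c′ p + 1)                          ≡⟨ ℤP.pos-+ (lookup c′ p) 1 ⟩
      + lookup c′ p ℤ.+ + 1                        ≡⟨ cong₂ ℤ._+_ (lookup-latticePoint-parallel t d′ c′ p)
                                                        (trans (indicatorℤ-++ʳ (allBut i) ⁅ p ⁆ p) (cong (λ b → if b then + 1 else + 0) (VP.[]=⇒lookup (x∈⁅x⁆ p)))) ⟨
      lookup (latticePoint t d′ c′) (k ↑ʳ p) ℤ.+ indicatorℤ (swapBasis i p) (k ↑ʳ p) ∎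
    ... | no q≢p = begin
      lookup (latticePoint (suc t) d c) (k ↑ʳ q)   ≡⟨ lookup-latticePoint-parallel (suc t) d c q ⟩
      + lookup c q                                 ≡⟨ cong +_ (c-others q q≢p) ⟩
      + lookup c′ q                                ≡⟨ ℤP.+-identityʳ _ ⟨
      + lookup c′ q ℤ.+ + 0                        ≡⟨ cong₂ ℤ._+_ (lookup-latticePoint-parallel t d′ c′ q)
                                                        (trans (indicatorℤ-++ʳ (allBut i) ⁅ p ⁆ q) (cong (λ b → if b then + 1 else + 0) (lookup-⁅⁆-≢ p q q≢p))) ⟨
      lookup (latticePoint t d′ c′) (k ↑ʳ q) ℤ.+ indicatorℤ (swapBasis i p) (k ↑ʳ q) ∎

  latticePoint∈dilate : ∀ t d c → V.sum d ≡ V.sum c → V.sum c ≤ t → InDilate k n t (latticePoint t d c)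
  latticePoint∈dilate zero d c d≡c c≤0 = [] , [] , refl , ↑-induction k a (λ e → lookup (latticePoint 0 d c) e ℚ./ 1 ≡ 0ℚ)
    (λ j → cong ℤtoℚ (trans (lookup-latticePoint-path 0 d c j) (cong (λ z → + 0 ℤ.- + z) (sum≡0⇒lookup≡0 d (trans d≡c c≡0) j))))
    (λ q → cong ℤtoℚ (trans (lookup-latticePoint-parallel 0 d c q) (cong +_ (sum≡0⇒lookup≡0 c c≡0 q))))
    where c≡0 = ℕP.n≤0⇒n≡0 c≤0
  latticePoint∈dilate (suc t) d c d≡c c≤1+t with V.sum c in c≡
  ... | zero = InDilate-suc {t = t} (latticePoint (suc t) d c) (latticePoint t d c) pathBasis
          (latticePoint∈dilate t d c (trans d≡c (sym c≡)) (subst (_≤ t) (sym c≡) z≤n))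
          pathBasis-isBasis (latticePoint-suc-pathBasis t d c)
  ... | suc s with decrement d s d≡c | decrement c s c≡
  ...   | i , d′ , d′≡s , d↓ | p , c′ , c′≡s , c↓ =
          InDilate-suc {t = t} (latticePoint (suc t) d c) (latticePoint t d′ c′) (swapBasis i p)
          (latticePoint∈dilate t d′ c′ (trans d′≡s (sym c′≡s)) (subst (_≤ t) (sym c′≡s) (ℕP.≤-pred c≤1+t)))
          (swapBasis-isBasis i p) (latticePoint-suc-swapBasis t d d′ c c′ d↓ c↓)

  weightedSum : List (Subset n × ℚ) → (Subset n → ℚ) → ℚ
  weightedSum L g = foldr (λ p s → proj₂ p ℚ.* g (proj₁ p) ℚ.+ s) 0ℚ L

  totalWeight : List (Subset n × ℚ) → ℚ
  totalWeight L = foldr (λ p s → proj₂ p ℚ.+ s) 0ℚ L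

  WeightedBasis : Subset n × ℚ → Set
  WeightedBasis p = IsBasisT k n (proj₁ p) × (0ℚ ℚ.≤ proj₂ p)

  weightedSum-mono-≤ : ∀ {L} → All WeightedBasis L → ∀ (g h : Subset n → ℚ) →
    (∀ B → IsBasisT k n B → g B ℚ.≤ h B) → weightedSum L g ℚ.≤ weightedSum L h
  weightedSum-mono-≤ [] g h g≤h = ℚP.≤-refl
  weightedSum-mono-≤ {(B , l) ∷ L} ((B-basis , l≥0) ∷ bases) g h g≤h =
    ℚP.+-mono-≤ (ℚP.*-monoˡ-≤-nonNeg l {{ℚ.nonNegative l≥0}} (g≤h B B-basis)) (weightedSum-mono-≤ bases g h g≤h)

  weightedSum-cong : ∀ {L} → All WeightedBasis L → ∀ (g h : Subset n → ℚ) →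
    (∀ B → IsBasisT k n B → g B ≡ h B) → weightedSum L g ≡ weightedSum L h
  weightedSum-cong [] g h g≡h = refl
  weightedSum-cong {(B , l) ∷ L} ((B-basis , _) ∷ bases) g h g≡h =
    cong₂ (λ u v → l ℚ.* u ℚ.+ v) (g≡h B B-basis) (weightedSum-cong bases g h g≡h)

  weightedSum-const : ∀ L c → weightedSum L (λ _ → c) ≡ c ℚ.* totalWeight L
  weightedSum-const []            c = sym (ℚP.*-zeroʳ c)
  weightedSum-const ((B , l) ∷ L) c =
    trans (cong₂ ℚ._+_ (ℚP.*-comm l c) (weightedSum-const L c)) (sym (ℚP.*-distribˡ-+ c l (totalWeight L)))

  weightedSum-0 : ∀ L → weightedSum L (λ _ → 0ℚ) ≡ 0ℚ
  weightedSum-0 L = trans (weightedSum-const L 0ℚ) (ℚP.*-zeroˡ (totalWeight L))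

  weightedSum-+ : ∀ L (g h : Subset n → ℚ) → weightedSum L (λ B → g B ℚ.+ h B) ≡ weightedSum L g ℚ.+ weightedSum L h
  weightedSum-+ []            g h = sym (ℚP.+-identityʳ 0ℚ)
  weightedSum-+ ((B , l) ∷ L) g h = trans (cong₂ ℚ._+_ (ℚP.*-distribˡ-+ l (g B) (h B)) (weightedSum-+ L g h))
    (ℚinterchange (l ℚ.* g B) (l ℚ.* h B) (weightedSum L g) (weightedSum L h))

  sumFin-weightedSum : ∀ L m (g : Fin m → Subset n → ℚ) →
    sumFin m (λ i → weightedSum L (g i)) ≡ weightedSum L (λ B → sumFin m (λ i → g i B))
  sumFin-weightedSum L zero    g = sym (weightedSum-0 L)
  sumFin-weightedSum L (suc m) g = trans (cong (weightedSum L (g F.zero) ℚ.+_) (sumFin-weightedSum L m (λ i → g (F.suc i))))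
    (sym (weightedSum-+ L (g F.zero) (λ B → sumFin m (λ i → g (F.suc i) B))))

  indicator-nonNeg : ∀ (B : Subset n) e → 0ℚ ℚ.≤ indicator B e
  indicator-nonNeg B e with lookup B e
  ... | true  = ℚP.nonNegative⁻¹ 1ℚ
  ... | false = ℚP.≤-refl

  indicator≤1 : ∀ (B : Subset n) e → indicator B e ℚ.≤ 1ℚ
  indicator≤1 B e with lookup B e
  ... | true  = ℚP.≤-refl
  ... | false = ℚP.<⇒≤ (ℚP.positive⁻¹ 1ℚ)

  sumFin-indicator-basis : ∀ B → IsBasisT k n B → sumFin n (indicator B) ≡ ℕtoℚ k
  sumFin-indicator-basis B (size , _) = trans (sumFin-indicator B) (cong ℕtoℚ size)

  sumFin-indicator-parallel≤1 : ∀ B → IsBasisT k n B → sumFin a (λ q → indicator B (k ↑ʳ q)) ℚ.≤ 1ℚ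
  sumFin-indicator-parallel≤1 B B-basis with V.splitAt k B
  ... | xs , ys , refl = ℚP.≤-trans
    (ℚP.≤-reflexive (trans (sumFin-cong a (λ q → cong (λ b → if b then 1ℚ else 0ℚ) (VP.lookup-++ʳ xs ys q)))
                           (sumFin-indicator ys)))
    (ℕtoℚ-mono-≤ {∣ ys ∣} {1} (atMostOneParallel xs ys B-basis))

  private
    module FromDilate (t : ℕ) (x : Vec ℤ n) (L : List (Subset n × ℚ)) (bases : All WeightedBasis L)
                      (total : totalWeight L ≡ ℕtoℚ t)
                      (coords : ∀ e → lookup x e ℚ./ 1 ≡ weightedSum L (λ B → indicator B e)) where

      totalWeight≡t : weightedSum L (λ _ → 1ℚ) ≡ ℕtoℚ t
      totalWeight≡t = trans (weightedSum-const L 1ℚ) (trans (ℚP.*-identityˡ _) total)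

      x-nonNeg : ∀ e → + 0 ℤ.≤ lookup x e
      x-nonNeg e = ℤtoℚ-cancel-≤ (ℚP.≤-trans (ℚP.≤-reflexive (sym (weightedSum-0 L)))
        (ℚP.≤-trans (weightedSum-mono-≤ bases _ _ (λ B _ → indicator-nonNeg B e)) (ℚP.≤-reflexive (sym (coords e)))))

      x≤t : ∀ e → lookup x e ℤ.≤ + t
      x≤t e = ℤtoℚ-cancel-≤ (ℚP.≤-trans (ℚP.≤-reflexive (coords e))
        (ℚP.≤-trans (weightedSum-mono-≤ bases _ _ (λ B _ → indicator≤1 B e)) (ℚP.≤-reflexive totalWeight≡t)))

      +∣x∣≡x : ∀ e → + ℤ.∣ lookup x e ∣ ≡ lookup x e
      +∣x∣≡x e = ℤP.0≤i⇒+∣i∣≡i (x-nonNeg e)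

      ℕtoℚ∣x∣ : ∀ e → ℕtoℚ ℤ.∣ lookup x e ∣ ≡ weightedSum L (λ B → indicator B e)
      ℕtoℚ∣x∣ e = trans (cong ℤtoℚ (+∣x∣≡x e)) (coords e)

      u : Fin k → ℕ
      u j = ℤ.∣ lookup x (j ↑ˡ a) ∣

      u≤t : ∀ j → u j ≤ t
      u≤t j = ℤP.drop‿+≤+ (subst (ℤ._≤ + t) (sym (+∣x∣≡x (j ↑ˡ a))) (x≤t (j ↑ˡ a)))

      d : Vec ℕ k
      d = V.tabulate (λ j → t ∸ u j)
      c : Vec ℕ a
      c = V.tabulate (λ q → ℤ.∣ lookup x (k ↑ʳ q) ∣)

      x≡latticePoint : x ≡ latticePoint t d c
      x≡latticePoint = lookup-extensionality (↑-induction k a (λ e → lookup x e ≡ lookup (latticePoint t d c) e) path parallel)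
        where
        path : ∀ j → lookup x (j ↑ˡ a) ≡ lookup (latticePoint t d c) (j ↑ˡ a)
        path j = sym (begin
          lookup (latticePoint t d c) (j ↑ˡ a) ≡⟨ lookup-latticePoint-path t d c j ⟩
          + t ℤ.- + lookup d j                 ≡⟨ cong (λ z → + t ℤ.- + z) (VP.lookup∘tabulate _ j) ⟩
          + t ℤ.- + (t ∸ u j)                  ≡⟨ ℤP.m-n≡m⊖n t (t ∸ u j) ⟩
          t ℤ.⊖ (t ∸ u j)                      ≡⟨ ℤP.⊖-≥ (ℕP.m∸n≤m t (u j)) ⟩
          + (t ∸ (t ∸ u j))                    ≡⟨ cong +_ (ℕP.m∸[m∸n]≡n (u≤t j)) ⟩
          + u j                                ≡⟨ +∣x∣≡x (j ↑ˡ a) ⟩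
          lookup x (j ↑ˡ a)                    ∎)
          where open ≡-Reasoning
        parallel : ∀ q → lookup x (k ↑ʳ q) ≡ lookup (latticePoint t d c) (k ↑ʳ q)
        parallel q = sym (trans (lookup-latticePoint-parallel t d c q)
                                (trans (cong +_ (VP.lookup∘tabulate _ q)) (+∣x∣≡x (k ↑ʳ q))))

      sum-c≤t : V.sum c ≤ t
      sum-c≤t = ℕtoℚ-cancel-≤ (begin
        ℕtoℚ (V.sum c)                                            ≡⟨ sumFin-ℕtoℚ a (λ q → ℤ.∣ lookup x (k ↑ʳ q) ∣) ⟨
        sumFin a (λ q → ℕtoℚ ℤ.∣ lookup x (k ↑ʳ q) ∣)              ≡⟨ sumFin-cong a (λ q → ℕtoℚ∣x∣ (k ↑ʳ q)) ⟩
        sumFin a (λ q → weightedSum L (λ B → indicator B (k ↑ʳ q))) ≡⟨ sumFin-weightedSum L a _ ⟩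
        weightedSum L (λ B → sumFin a (λ q → indicator B (k ↑ʳ q))) ≤⟨ weightedSum-mono-≤ bases _ _ sumFin-indicator-parallel≤1 ⟩
        weightedSum L (λ _ → 1ℚ)                                  ≡⟨ totalWeight≡t ⟩
        ℕtoℚ t                                                    ∎)
        where open ℚP.≤-Reasoning

      -- every basis has k elements, so the coordinates of x add up to k t
      sum-u+sum-c≡k*t : V.sum (V.tabulate u) + V.sum c ≡ k * t
      sum-u+sum-c≡k*t = ℕtoℚ-injective (begin
        ℕtoℚ (V.sum (V.tabulate u) + V.sum c)                          ≡⟨ ℕtoℚ-+ (V.sum (V.tabulate u)) (V.sum c) ⟩
        ℕtoℚ (V.sum (V.tabulate u)) ℚ.+ ℕtoℚ (V.sum c)                 ≡⟨ cong₂ ℚ._+_ (sumFin-ℕtoℚ k u) (sumFin-ℕtoℚ a (λ q → ℤ.∣ lookup x (k ↑ʳ q) ∣)) ⟨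
        sumFin k (λ j → ℕtoℚ (u j)) ℚ.+ sumFin a (λ q → ℕtoℚ ℤ.∣ lookup x (k ↑ʳ q) ∣)
                                                                       ≡⟨ sumFin-↑ k a (λ e → ℕtoℚ ℤ.∣ lookup x e ∣) ⟨
        sumFin n (λ e → ℕtoℚ ℤ.∣ lookup x e ∣)                          ≡⟨ sumFin-cong n ℕtoℚ∣x∣ ⟩
        sumFin n (λ e → weightedSum L (λ B → indicator B e))            ≡⟨ sumFin-weightedSum L n (λ e B → indicator B e) ⟩
        weightedSum L (λ B → sumFin n (indicator B))                    ≡⟨ weightedSum-cong bases _ _ sumFin-indicator-basis ⟩
        weightedSum L (λ _ → ℕtoℚ k)                                   ≡⟨ weightedSum-const L (ℕtoℚ k) ⟩
        ℕtoℚ k ℚ.* totalWeight L                                       ≡⟨ cong (ℕtoℚ k ℚ.*_) total ⟩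
        ℕtoℚ k ℚ.* ℕtoℚ t                                              ≡⟨ ℕtoℚ-* k t ⟨
        ℕtoℚ (k * t)                                                   ∎)
        where open ≡-Reasoning

      sum-d≡sum-c : V.sum d ≡ V.sum c
      sum-d≡sum-c = ℕP.+-cancelʳ-≡ (V.sum (V.tabulate u)) (V.sum d) (V.sum c)
        (trans (sum-tabulate-complement k t (λ j → t ∸ u j) u (λ j → ℕP.m∸n+n≡m (u≤t j)))
               (sym (trans (ℕP.+-comm (V.sum c) _) sum-u+sum-c≡k*t)))

  dilate⇒latticePoint : ∀ t x → InDilate k n t x →
    Σ (Vec ℕ k) λ d → Σ (Vec ℕ a) λ c → V.sum d ≡ V.sum c × V.sum c ≤ t × x ≡ latticePoint t d c
  dilate⇒latticePoint t x (L , bases , total , coords) = d , c , sum-d≡sum-c , sum-c≤t , x≡latticePoint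
    where open FromDilate t x L bases total coords

map-injective : ∀ {A B : Set} {m} (f : A → B) → (∀ {x y} → f x ≡ f y → x ≡ y) →
  ∀ {u v : Vec A m} → V.map f u ≡ V.map f v → u ≡ v
map-injective f f-inj {[]}    {[]}    _ = refl
map-injective f f-inj {x ∷ u} {y ∷ v} e = cong₂ _∷_ (f-inj (cong V.head e)) (map-injective f f-inj (cong V.tail e))

+t-+x-injective : ∀ t {x y : ℕ} → + t ℤ.- + x ≡ + t ℤ.- + y → x ≡ y
+t-+x-injective t {x} {y} e = ℤP.+-injective
  (trans (twice-negated (+ t) (+ x)) (trans (cong (λ z → + t ℤ.- z) e) (sym (twice-negated (+ t) (+ y)))))
  where twice-negated : ∀ T X → X ≡ T ℤ.- (T ℤ.- X)
        twice-negated = ℤ-Solver.solve-∀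

module LatticeCounting (K A : ℕ) where

  k a : ℕ
  k = suc K
  a = suc A
  open Bases k a using (n)
  open LatticePoints k a

  latticePointOf : ℕ → Vec ℕ k × Vec ℕ a → Vec ℤ n
  latticePointOf t (d , c) = latticePoint t d c

  latticePoints : ℕ → List (Vec ℤ n)
  latticePoints t = map (latticePointOf t) (equalSumPairsUpTo k a t)

  latticePointOf-injective : ∀ t {p q} → latticePointOf t p ≡ latticePointOf t q → p ≡ q
  latticePointOf-injective t {d , c} {d′ , c′} e with VP.++-injective (V.map (λ x → + t ℤ.- + x) d) (V.map (λ x → + t ℤ.- + x) d′) e
  ... | d-part , c-part = cong₂ _,_ (map-injective _ (+t-+x-injective t) d-part) (map-injective +_ ℤP.+-injective c-part)

  ∈-latticePoints⇒InDilate : ∀ t x → x ∈ latticePoints t → InDilate k n t x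
  ∈-latticePoints⇒InDilate t x x∈ with ∈-map⁻ (latticePointOf t) x∈
  ... | (d , c) , p∈ , refl with equalSumPairsUpTo-sound k a t p∈
  ...   | d≡c , c≤t = latticePoint∈dilate t d c d≡c c≤t

  InDilate⇒∈-latticePoints : ∀ t x → InDilate k n t x → x ∈ latticePoints t
  InDilate⇒∈-latticePoints t x x∈tP = fromPair (dilate⇒latticePoint t x x∈tP)
    where
    fromPair : (Σ (Vec ℕ k) λ d → Σ (Vec ℕ a) λ c → V.sum d ≡ V.sum c × V.sum c ≤ t × x ≡ latticePoint t d c) →
               x ∈ latticePoints t
    fromPair (d , c , d≡c , c≤t , x≡point) =
      subst (_∈ latticePoints t) (sym x≡point) (∈-map⁺ (latticePointOf t) (∈-equalSumPairsUpTo k a t d c d≡c c≤t))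

  latticeCount : ∀ t → LatticeCount k n t (length (latticePoints t))
  latticeCount t = latticePoints t , Unique.map⁺ (latticePointOf-injective t) (equalSumPairsUpTo-unique k a t) ,
    (λ x → mk⇔ (∈-latticePoints⇒InDilate t x) (InDilate⇒∈-latticePoints t x)) , refl

  length-latticePoints : ∀ t → length (latticePoints t) ≡ diagonalSum A K t
  length-latticePoints t = trans (LP.length-map (latticePointOf t) (equalSumPairsUpTo k a t))
    (trans (length-equalSumPairsUpTo k a t) (sumℕ-cong (suc t) (λ s _ →
      trans (cong₂ _*_ (length-compositions K s) (length-compositions A s)) (ℕP.*-comm (binomial (s + K) K) _))))

Corollary3p4 : ℕ → ℕ → Set
Corollary3p4 k n =
  (∀ t → Σ ℕ (λ c → LatticeCount k n t c × (ℕtoℚ c ≡ Dpoly k n t) × (ℕtoℚ c ≡ Dformula k n t)))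
  × (∀ m → m < n → 0ℚ <ℚ dcoeff k n m)

corollary3p4-shifted : ∀ K A → Corollary3p4 (suc K) (suc K + suc A)
corollary3p4-shifted K A =
  (λ t → length (latticePoints t) , latticeCount t , trans (count≡Dformula t) (sym (Dpoly≡Dformula t)) , count≡Dformula t)
  , dcoeff-pos
  where
  open ClosedForms K A using (Dpoly≡Dformula; dcoeff-pos; diagonalSum≡Dformula)
  open LatticeCounting K A using (latticePoints; latticeCount; length-latticePoints)
  count≡Dformula : ∀ t → ℕtoℚ (length (latticePoints t)) ≡ Dformula (suc K) (suc K + suc A) t
  count≡Dformula t = trans (cong ℕtoℚ (length-latticePoints t)) (diagonalSum≡Dformula t)

corollary3p4 : (k n : ℕ) → 1 ≤ k → k < n →
    (∀ t → Σ ℕ (λ c → LatticeCount k n t c × (ℕtoℚ c ≡ Dpoly k n t) × (ℕtoℚ c ≡ Dformula k n t)))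
    × (∀ m → m < n → 0ℚ <ℚ dcoeff k n m)
corollary3p4 (suc K) n _ k<n = subst (Corollary3p4 (suc K)) n≡k+a (corollary3p4-shifted K (n ∸ suc (suc K)))
  where
  n≡k+a : suc K + suc (n ∸ suc (suc K)) ≡ n
  n≡k+a = trans (ℕP.+-suc (suc K) (n ∸ suc (suc K))) (ℕP.m+[n∸m]≡n k<n)
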